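{- Let $\mathcal{P}_2$ be the set of partitions $\lambda=(\lambda_1,\ldots,\lambda_\ell)$ whose odd-indexed parts $\lambda_1,\lambda_3,\ldots$ are all even. Then, as formal power series in $a,b,c,d$, $$\sum_{\lambda\in\mathcal{P}_{2}}\omega(\lambda)=\sum_{n=0}^{\infty}\frac{Q^{n}(-1/d;Q)_{n}}{(ab;Q)_{n}(Q;Q)_{n}}+\sum_{n=0}^{\infty}\frac{abQ^{n}(-Q/d;Q)_{n}}{(ab;Q)_{n+1}(Q;Q)_{n}}=\frac{(-Q/d;Q)_{\infty}}{(ab;Q)_{\infty}(Q;Q)_{\infty}}.$$
   Context: A partition is a finite weakly decreasing sequence $\lambda=(\lambda_1,\ldots,\lambda_\ell)$ of positive integers (the empty partition is included); $\lambda_i=0$ for $i>\ell$. The four-parameter weight of $\lambda$ is $$\omega(\lambda)=a^{\sum_{i\ge1}\lceil\lambda_{2i-1}/2\rceil}\,b^{\sum_{i\ge1}\lfloor\lambda_{2i-1}/2\rfloor}\,c^{\sum_{i\ge1}\lceil\lambda_{2i}/2\rceil}\,d^{\sum_{i\ge1}\lfloor\lambda_{2i}/2\rfloor},$$ and $Q:=abcd$ (so $Q/d=abc$). $(x;q)_0=1$, $(x;q)_n=\prod_{i=0}^{n-1}(1-xq^i)$, $(x;q)_\infty=\prod_{i\ge0}(1-xq^i)$. -}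

module Defs where

open import Data.Nat as ℕ using (ℕ; zero; suc; _<_; ⌈_/2⌉; ⌊_/2⌋)
open import Data.Nat.Divisibility using (_∣_)
open import Data.Integer as ℤ using (ℤ; +_)
open import Data.Bool using (Bool; true; false; _∧_; if_then_else_)
open import Data.List using (List; []; _∷_; map)
open import Data.Nat.ListAction using (sum)
open import Data.List.Relation.Unary.All using (All)
open import Data.List.Relation.Unary.Linked using (Linked)
open import Data.Product using (Σ; _×_; _,_)
open import Relation.Binary.PropositionalEquality using (_≡_)
open import Relation.Nullary.Decidable using (⌊_⌋)

record Partition : Set where
  constructor mkPartition
  field
    parts    : List ℕ
    positive : All (λ x → 0 < x) parts
    decr     : Linked ℕ._≥_ parts
open Partition public

-- odd-indexed (λ₁, λ₃, …) and even-indexed (λ₂, λ₄, …) parts (1-based)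
oddParts  : List ℕ → List ℕ
evenParts : List ℕ → List ℕ
oddParts  []       = []
oddParts  (x ∷ xs) = x ∷ evenParts xs
evenParts []       = []
evenParts (x ∷ xs) = oddParts xs

-- exponent vector (of a, b, c, d) of the weight ω(λ)
weightExp : Partition → ℕ × ℕ × ℕ × ℕ
weightExp p =
  ( sum (map ⌈_/2⌉ (oddParts (parts p)))
  , sum (map ⌊_/2⌋ (oddParts (parts p)))
  , sum (map ⌈_/2⌉ (evenParts (parts p)))
  , sum (map ⌊_/2⌋ (evenParts (parts p))) )

InP2 : Partition → Set
InP2 p = All (λ x → 2 ∣ x) (oddParts (parts p))

P2With : ℕ → ℕ → ℕ → ℕ → Set
P2With i j k l = Σ Partition (λ p → InP2 p × weightExp p ≡ (i , j , k , l))

-- Formal power series in a, b, c, d with integer coefficients: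
-- F i j k l is the coefficient of a^i b^j c^k d^l.

FPS : Set
FPS = ℕ → ℕ → ℕ → ℕ → ℤ

sumTo : ℕ → (ℕ → ℤ) → ℤ
sumTo zero    f = f 0
sumTo (suc n) f = sumTo n f ℤ.+ f (suc n)

_⊕_ : FPS → FPS → FPS
(f ⊕ g) i j k l = f i j k l ℤ.+ g i j k l

_⊛_ : FPS → FPS → FPS
(f ⊛ g) i j k l =
  sumTo i λ p → sumTo j λ q → sumTo k λ r → sumTo l λ s →
    f p q r s ℤ.* g (i ℕ.∸ p) (j ℕ.∸ q) (k ℕ.∸ r) (l ℕ.∸ s)

infixl 6 _⊕_
infixl 7 _⊛_

mon : ℕ → ℕ → ℕ → ℕ → FPS
mon p q r s i j k l =
  if ⌊ i ℕ.≟ p ⌋ ∧ ⌊ j ℕ.≟ q ⌋ ∧ ⌊ k ℕ.≟ r ⌋ ∧ ⌊ l ℕ.≟ s ⌋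
  then + 1 else + 0

one : FPS
one = mon 0 0 0 0

neg : FPS → FPS
neg f i j k l = ℤ.- f i j k l

deg : ℕ → ℕ → ℕ → ℕ → ℕ
deg i j k l = i ℕ.+ j ℕ.+ k ℕ.+ l

-- Infinite sum Σ_{n≥0} f n, for sequences with ord(f n) ≥ n (so the
-- coefficient of a monomial of total degree D only involves n ≤ D).
sumInf : (ℕ → FPS) → FPS
sumInf f i j k l = sumTo (deg i j k l) (λ n → f n i j k l)

prodBelow : ℕ → (ℕ → FPS) → FPS
prodBelow zero    f = one
prodBelow (suc n) f = prodBelow n f ⊛ f n

-- Infinite product Π_{n≥0} f n, for sequences with ord(f n - 1) ≥ n+1
-- (so the coefficient of a monomial of total degree D only involves n < D+1).
prodInf : (ℕ → FPS) → FPS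
prodInf f i j k l = prodBelow (suc (deg i j k l)) f i j k l

-- 1 / (1 - a^p b^q c^r d^s) = Σ_{t≥0} (a^p b^q c^r d^s)^t, used only with p+q+r+s ≥ 1
geom : ℕ → ℕ → ℕ → ℕ → FPS
geom p q r s = sumInf (λ t → mon (t ℕ.* p) (t ℕ.* q) (t ℕ.* r) (t ℕ.* s))

-- The specific series (Q = abcd, Q/d = abc)

Qpow : ℕ → FPS
Qpow n = mon n n n n

-- 1/(ab;Q)_n = Π_{i<n} 1/(1 - ab Q^i)
invAbQ : ℕ → FPS
invAbQ n = prodBelow n (λ i → geom (suc i) (suc i) i i)

-- 1/(Q;Q)_n = Π_{i<n} 1/(1 - Q^{i+1})
invQQ : ℕ → FPS
invQQ n = prodBelow n (λ i → geom (suc i) (suc i) (suc i) (suc i))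

-- (-Q/d;Q)_n = Π_{i<n} (1 + abc Q^i)
negQdPoch : ℕ → FPS
negQdPoch n = prodBelow n (λ i → one ⊕ mon (suc i) (suc i) (suc i) i)

-- Q^n (-1/d;Q)_n = Π_{i<n} Q (1 + Q^i/d) = Π_{i<n} (Q + abc Q^i)
QnNeg1dPoch : ℕ → FPS
QnNeg1dPoch n = prodBelow n (λ i → Qpow 1 ⊕ mon (suc i) (suc i) (suc i) i)

term1 : ℕ → FPS
term1 n = QnNeg1dPoch n ⊛ invAbQ n ⊛ invQQ n

term2 : ℕ → FPS
term2 n = mon 1 1 0 0 ⊛ Qpow n ⊛ negQdPoch n ⊛ invAbQ (suc n) ⊛ invQQ n

middleSeries : FPS
middleSeries = sumInf term1 ⊕ sumInf term2

productSeries : FPS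
productSeries =
  prodInf (λ i → one ⊕ mon (suc i) (suc i) (suc i) i)
  ⊛ prodInf (λ i → geom (suc i) (suc i) i i)
  ⊛ prodInf (λ i → geom (suc i) (suc i) (suc i) (suc i))

-- Every series in the statement is the generating function of a class of weighted objects with
-- finitely many objects of each weight, so equal coefficients follow from weight-preserving
-- bijections; in an infinite product only the factors of index below the degree of a monomial
-- contribute to its coefficient.
--
-- A monomial of (-Q/d;Q)_∞ / ((ab;Q)_∞ (Q;Q)_∞) is a finitely supported sequence of triples
-- (γₙ, αₙ, βₙ) ∈ 𝔹 × ℕ × ℕ, the n-th one weighing (abcQⁿ)^γₙ (abQⁿ)^αₙ (Qⁿ⁺¹)^βₙ. Sorting the
-- sequences by their last nonzero triple gives the middle expression. If it sits at position n and
-- is (0, α+1, 0), the sequence is a term of the second sum, ab Qⁿ accounting for one unit of α.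
-- Otherwise it is a term of the first sum with n + 1 factors: of Qⁿ⁺¹(-1/d;Q)ₙ₊₁ = ∏ᵢ (Q + abcQⁱ),
-- the first factor Q + abc decides whether the last triple has β ≥ 1 or γ = 1, and the others,
-- Q + abcQⁱ⁺¹ = Q (1 + abcQⁱ), carry the earlier γ's.
--
-- Finally, with hₙ the total α + β + γ of the triples after position n, the parts
--   λ₂ₙ₊₁ = 2 (αₙ + βₙ + γₙ + hₙ),   λ₂ₙ₊₂ = γₙ + 2 (βₙ + hₙ)
-- form a partition in 𝒫₂ whose weight ω(λ) is the weight of the sequence, and each λ ∈ 𝒫₂ arises
-- from exactly one sequence.

module Submission where

open import Defs
open import Algebra.Bundles using (CommutativeMonoid)
import Algebra.Solver.CommutativeMonoid as CommutativeMonoidSolver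
open import Algebra.Structures using (IsCommutativeMonoid)
open import Axiom.UniquenessOfIdentityProofs.WithK using (uip)
open import Data.Bool using (Bool; true; false; _∧_; if_then_else_)
open import Data.Fin using (Fin)
open import Data.Fin.Permutation using (↔⇒≡)
open import Data.Fin.Properties using (+↔⊎; *↔×)
open import Data.Integer as ℤ using (ℤ; +_)
import Data.Integer.Properties as ℤ
open import Data.List as List using (List; []; _∷_; _++_; length)
import Data.List.Properties as List
open import Data.List.Relation.Unary.All as All using (All; []; _∷_)
open import Data.List.Relation.Unary.Linked as Linked using (Linked; []; [-]; _∷_)
open import Data.Nat as ℕ
  using ( ℕ; zero; suc; _+_; _*_; _∸_; _≤_; _<_; _≥_; _≤′_; ≤′-refl; ≤′-step; z≤n; s≤s; s≤s⁻¹
        ; ⌊_/2⌋; ⌈_/2⌉)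
open import Data.Nat.Divisibility using (_∣_; divides)
open import Data.Nat.ListAction using (sum)
open import Data.Nat.Properties
open import Data.Nat.Tactic.RingSolver using (solve-∀)
open import Data.Product using (Σ; _×_; _,_; proj₁; proj₂; uncurry)
open import Data.Product.Function.Dependent.Propositional using (Σ-↔)
open import Data.Product.Function.NonDependent.Propositional using (_×-↔_)
open import Data.Sum using (_⊎_; inj₁; inj₂; [_,_])
open import Data.Sum.Function.Propositional using (_⊎-↔_)
open import Data.Unit using (⊤; tt)
open import Data.Vec as Vec using (Vec; []; _∷_; _∷ʳ_; init; last; zip; unzip; toList)
import Data.Vec.Properties as Vec
open import Function.Base using (_∘_)
open import Function.Bundles using (_↔_; mk↔ₛ′; Inverse)
open import Function.Properties.Inverse using (↔-refl; ↔-sym; ↔-trans)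
open import Function.Related.TypeIsomorphisms using (Σ-assoc; Σ-distribʳ-⊎)
open import Relation.Binary.PropositionalEquality hiding ([_])
open import Relation.Nullary using (yes; no; ¬_; contradiction)
open import Relation.Nullary.Decidable using (⌊_⌋)

open Inverse using (to; from; strictlyInverseˡ; strictlyInverseʳ)

Weight : Set
Weight = ℕ × ℕ × ℕ × ℕ

infixl 6 _+ʷ_ _∸ʷ_
infixl 7 _·ʷ_
infix 4 _≤ʷ_

_+ʷ_ : Weight → Weight → Weight
(a , b , c , d) +ʷ (a′ , b′ , c′ , d′) = (a + a′ , b + b′ , c + c′ , d + d′)

_∸ʷ_ : Weight → Weight → Weight
(a , b , c , d) ∸ʷ (a′ , b′ , c′ , d′) = (a ∸ a′ , b ∸ b′ , c ∸ c′ , d ∸ d′)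

_·ʷ_ : ℕ → Weight → Weight
t ·ʷ (a , b , c , d) = (t * a , t * b , t * c , t * d)

_≤ʷ_ : Weight → Weight → Set
(a , b , c , d) ≤ʷ (a′ , b′ , c′ , d′) = a ≤ a′ × b ≤ b′ × c ≤ c′ × d ≤ d′

0ʷ : Weight
0ʷ = (0 , 0 , 0 , 0)

∣_∣ʷ : Weight → ℕ
∣ (i , j , k , l) ∣ʷ = deg i j k l

coeff : FPS → Weight → ℤ
coeff f (i , j , k , l) = f i j k l

monʷ : Weight → FPS
monʷ (p , q , r , s) = mon p q r s

cong-weight : ∀ {a b c d a′ b′ c′ d′ : ℕ} → a ≡ a′ → b ≡ b′ → c ≡ c′ → d ≡ d′ →
              (a , b , c , d) ≡ (a′ , b′ , c′ , d′)
cong-weight refl refl refl refl = refl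

+ʷ-isCommutativeMonoid : IsCommutativeMonoid _≡_ _+ʷ_ 0ʷ
+ʷ-isCommutativeMonoid = record
  { isMonoid = record
    { isSemigroup = record
      { isMagma = record { isEquivalence = isEquivalence ; ∙-cong = cong₂ _+ʷ_ }
      ; assoc = λ (a , b , c , d) (a′ , b′ , c′ , d′) (a″ , b″ , c″ , d″) →
          cong-weight (+-assoc a a′ a″) (+-assoc b b′ b″) (+-assoc c c′ c″) (+-assoc d d′ d″)
      }
    ; identity = (λ _ → refl) , λ (a , b , c , d) →
        cong-weight (+-identityʳ a) (+-identityʳ b) (+-identityʳ c) (+-identityʳ d)
    }
  ; comm = λ (a , b , c , d) (a′ , b′ , c′ , d′) →
      cong-weight (+-comm a a′) (+-comm b b′) (+-comm c c′) (+-comm d d′)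
  }

+ʷ-commutativeMonoid : CommutativeMonoid _ _
+ʷ-commutativeMonoid = record { isCommutativeMonoid = +ʷ-isCommutativeMonoid }

module +ʷ-Solver = CommutativeMonoidSolver +ʷ-commutativeMonoid

open IsCommutativeMonoid +ʷ-isCommutativeMonoid
  using () renaming (assoc to +ʷ-assoc; identityʳ to +ʷ-identityʳ)

∣+ʷ∣ : ∀ u v → ∣ u +ʷ v ∣ʷ ≡ ∣ u ∣ʷ + ∣ v ∣ʷ
∣+ʷ∣ (a , b , c , d) (a′ , b′ , c′ , d′) = interchange a b c d a′ b′ c′ d′
  where
  interchange : ∀ a b c d a′ b′ c′ d′ →
          (a + a′) + (b + b′) + (c + c′) + (d + d′) ≡ (a + b + c + d) + (a′ + b′ + c′ + d′)
  interchange = solve-∀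

∣·ʷ∣ : ∀ t u → ∣ t ·ʷ u ∣ʷ ≡ t * ∣ u ∣ʷ
∣·ʷ∣ t (a , b , c , d) = distrib t a b c d
  where
  distrib : ∀ t a b c d → t * a + t * b + t * c + t * d ≡ t * (a + b + c + d)
  distrib = solve-∀

head≤∣∣ʷ : ∀ {a b c d} → a ≤ ∣ (a , b , c , d) ∣ʷ
head≤∣∣ʷ {a} {b} {c} {d} = ≤-trans (m≤m+n a b) (≤-trans (m≤m+n _ c) (m≤m+n _ d))

∣∣ʷ-≤-+ʷ : ∀ u v → ∣ u ∣ʷ ≤ ∣ u +ʷ v ∣ʷ
∣∣ʷ-≤-+ʷ u v = ≤-trans (m≤m+n ∣ u ∣ʷ ∣ v ∣ʷ) (≤-reflexive (sym (∣+ʷ∣ u v)))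

∣∣ʷ-mono : ∀ {u w} → u ≤ʷ w → ∣ u ∣ʷ ≤ ∣ w ∣ʷ
∣∣ʷ-mono (a , b , c , d) = +-mono-≤ (+-mono-≤ (+-mono-≤ a b) c) d

≤ʷ-refl : ∀ {w} → w ≤ʷ w
≤ʷ-refl = ≤-refl , ≤-refl , ≤-refl , ≤-refl

≤ʷ-trans : ∀ {u v w} → u ≤ʷ v → v ≤ʷ w → u ≤ʷ w
≤ʷ-trans (a , b , c , d) (a′ , b′ , c′ , d′) =
  ≤-trans a a′ , ≤-trans b b′ , ≤-trans c c′ , ≤-trans d d′

≤ʷ-irrelevant : ∀ {u w} (p q : u ≤ʷ w) → p ≡ q
≤ʷ-irrelevant (a , b , c , d) (a′ , b′ , c′ , d′)
  rewrite ≤-irrelevant a a′ | ≤-irrelevant b b′ | ≤-irrelevant c c′ | ≤-irrelevant d d′ = refl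

∸ʷ-≤ʷ : ∀ w u → w ∸ʷ u ≤ʷ w
∸ʷ-≤ʷ (i , j , k , l) (p , q , r , s) = m∸n≤m i p , m∸n≤m j q , m∸n≤m k r , m∸n≤m l s

+ʷ-∸ʷ : ∀ {u w} → u ≤ʷ w → u +ʷ (w ∸ʷ u) ≡ w
+ʷ-∸ʷ (a , b , c , d) = cong-weight (m+[n∸m]≡n a) (m+[n∸m]≡n b) (m+[n∸m]≡n c) (m+[n∸m]≡n d)

+ʷ-split : ∀ u v {w} → u +ʷ v ≡ w → u ≤ʷ w × v ≡ w ∸ʷ u
+ʷ-split (a , b , c , d) (a′ , b′ , c′ , d′) refl =
  (m≤m+n a a′ , m≤m+n b b′ , m≤m+n c c′ , m≤m+n d d′) ,
  sym (cong-weight (m+n∸m≡n a a′) (m+n∸m≡n b b′) (m+n∸m≡n c c′) (m+n∸m≡n d d′))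

∑≤ : ℕ → (ℕ → ℕ) → ℕ
∑≤ zero    g = g 0
∑≤ (suc n) g = ∑≤ n g + g (suc n)

sumTo-+ : ∀ n (g : ℕ → ℕ) → sumTo n (λ p → + g p) ≡ + ∑≤ n g
sumTo-+ zero    g = refl
sumTo-+ (suc n) g = cong (ℤ._+ + g (suc n)) (sumTo-+ n g)

sumTo-cong : ∀ n {F G : ℕ → ℤ} → (∀ p → p ≤ n → F p ≡ G p) → sumTo n F ≡ sumTo n G
sumTo-cong zero    F≗G = F≗G 0 z≤n
sumTo-cong (suc n) F≗G =
  cong₂ ℤ._+_ (sumTo-cong n (λ p p≤n → F≗G p (m≤n⇒m≤1+n p≤n))) (F≗G (suc n) ≤-refl)

Σ≤ : (ℕ → Set) → ℕ → Set
Σ≤ G n = Σ ℕ λ p → p ≤ n × G p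

Σ≤-zero : {G : ℕ → Set} → G 0 ↔ Σ≤ G 0
Σ≤-zero = mk↔ₛ′ (λ x → 0 , z≤n , x) (λ { (0 , _ , x) → x })
                (λ { (0 , z≤n , x) → refl }) (λ _ → refl)

Σ≤-suc : ∀ {G : ℕ → Set} n → (Σ≤ G n ⊎ G (suc n)) ↔ Σ≤ G (suc n)
Σ≤-suc {G} n = mk↔ₛ′ to′ from′ to∘from from∘to
  where
  to′ : Σ≤ G n ⊎ G (suc n) → Σ≤ G (suc n)
  to′ (inj₁ (p , p≤n , x)) = p , m≤n⇒m≤1+n p≤n , x
  to′ (inj₂ x)             = suc n , ≤-refl , x
  from′ : Σ≤ G (suc n) → Σ≤ G n ⊎ G (suc n)
  from′ (p , p≤1+n , x) with p ℕ.≟ suc n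
  ... | yes refl = inj₂ x
  ... | no p≢1+n = inj₁ (p , s≤s⁻¹ (≤∧≢⇒< p≤1+n p≢1+n) , x)
  to∘from : ∀ y → to′ (from′ y) ≡ y
  to∘from (p , p≤1+n , x) with p ℕ.≟ suc n
  ... | yes refl = cong (λ le → suc n , le , x) (≤-irrelevant _ _)
  ... | no _     = cong (λ le → p , le , x) (≤-irrelevant _ _)
  from∘to : ∀ y → from′ (to′ y) ≡ y
  from∘to (inj₁ (p , p≤n , x)) with p ℕ.≟ suc n
  ... | yes refl = contradiction p≤n 1+n≰n
  ... | no _     = cong (λ le → inj₁ (p , le , x)) (≤-irrelevant _ _)
  from∘to (inj₂ x) with suc n ℕ.≟ suc n
  ... | yes refl = refl
  ... | no 1+n≢1+n = contradiction refl 1+n≢1+n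

Fin-∑≤ : ∀ n {g : ℕ → ℕ} {G : ℕ → Set} → (∀ p → Fin (g p) ↔ G p) → Fin (∑≤ n g) ↔ Σ≤ G n
Fin-∑≤ zero    e = ↔-trans (e 0) Σ≤-zero
Fin-∑≤ (suc n) e = ↔-trans +↔⊎ (↔-trans (Fin-∑≤ n e ⊎-↔ e (suc n)) (Σ≤-suc n))

-- coeff (f ⊛ g) w unfolds to sumToʷ w (λ v → coeff f v ℤ.* coeff g (w ∸ʷ v)).
sumToʷ : Weight → (Weight → ℤ) → ℤ
sumToʷ (i , j , k , l) F =
  sumTo i λ p → sumTo j λ q → sumTo k λ r → sumTo l λ s → F (p , q , r , s)

∑≤ʷ : Weight → (Weight → ℕ) → ℕ
∑≤ʷ (i , j , k , l) g = ∑≤ i λ p → ∑≤ j λ q → ∑≤ k λ r → ∑≤ l λ s → g (p , q , r , s)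

Σ≤ʷ : (Weight → Set) → Weight → Set
Σ≤ʷ G w = Σ Weight λ v → v ≤ʷ w × G v

sumToʷ-cong : ∀ w {F G : Weight → ℤ} → (∀ v → v ≤ʷ w → F v ≡ G v) → sumToʷ w F ≡ sumToʷ w G
sumToʷ-cong (i , j , k , l) F≗G =
  sumTo-cong i λ p p≤i → sumTo-cong j λ q q≤j → sumTo-cong k λ r r≤k → sumTo-cong l λ s s≤l →
    F≗G (p , q , r , s) (p≤i , q≤j , r≤k , s≤l)

sumToʷ-+ : ∀ w (g : Weight → ℕ) → sumToʷ w (λ v → + g v) ≡ + ∑≤ʷ w g
sumToʷ-+ (i , j , k , l) g =
  trans (sumTo-cong i λ p _ → trans (sumTo-cong j λ q _ → trans (sumTo-cong k λ r _ →
          sumTo-+ l _) (sumTo-+ k _)) (sumTo-+ j _))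
        (sumTo-+ i _)

Fin-∑≤ʷ : ∀ w {g : Weight → ℕ} {G : Weight → Set} →
          (∀ v → Fin (g v) ↔ G v) → Fin (∑≤ʷ w g) ↔ Σ≤ʷ G w
Fin-∑≤ʷ (i , j , k , l) e =
  ↔-trans (Fin-∑≤ i λ p → Fin-∑≤ j λ q → Fin-∑≤ k λ r → Fin-∑≤ l λ s → e (p , q , r , s))
          (mk↔ₛ′ (λ (p , p≤i , q , q≤j , r , r≤k , s , s≤l , x) →
                    (p , q , r , s) , (p≤i , q≤j , r≤k , s≤l) , x)
                 (λ ((p , q , r , s) , (p≤i , q≤j , r≤k , s≤l) , x) →
                    (p , p≤i , q , q≤j , r , r≤k , s , s≤l , x))
                 (λ _ → refl) (λ _ → refl))

-- Weighted classes and their generating series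

fibre : {X : Set} → (X → Weight) → Weight → Set
fibre {X} f w = Σ X λ x → f x ≡ w

fibre-≡ : {X : Set} {f : X → Weight} {w : Weight} {x y : X} {e : f x ≡ w} {e′ : f y ≡ w} →
          x ≡ y → _≡_ {A = fibre f w} (x , e) (y , e′)
fibre-≡ refl = cong (_ ,_) (uip _ _)

fibre-↔ : {X Y : Set} {f : X → Weight} {g : Y → Weight} (e : X ↔ Y) →
          (∀ x → g (to e x) ≡ f x) → ∀ w → fibre f w ↔ fibre g w
fibre-↔ e g∘e≗f w = Σ-↔ e λ {x} →
  mk↔ₛ′ (trans (g∘e≗f x)) (trans (sym (g∘e≗f x))) (λ _ → uip _ _) (λ _ → uip _ _)

record Class : Set₁ where
  field
    Obj    : Set
    weight : Obj → Weight
    count  : Weight → ℕ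
    enum   : ∀ w → Fin (count w) ↔ fibre weight w
open Class public

Fibre : Class → Weight → Set
Fibre C = fibre (weight C)

count-≡ : ∀ A B {w} → Fibre A w ↔ Fibre B w → count A w ≡ count B w
count-≡ A B {w} e = ↔⇒≡ (↔-trans (enum A w) (↔-trans e (↔-sym (enum B w))))

Fin0↔ : {A : Set} → ¬ A → Fin 0 ↔ A
Fin0↔ ¬a = mk↔ₛ′ (λ ()) (λ a → contradiction a ¬a) (λ a → contradiction a ¬a) (λ ())

monomialᶜ : Weight → Class
monomialᶜ u@(p , q , r , s) = record
  { Obj = ⊤ ; weight = λ _ → u ; count = count′ ; enum = enum′ }
  where
  count′ : Weight → ℕ
  count′ (i , j , k , l) =
    if ⌊ i ℕ.≟ p ⌋ ∧ ⌊ j ℕ.≟ q ⌋ ∧ ⌊ k ℕ.≟ r ⌋ ∧ ⌊ l ℕ.≟ s ⌋ then 1 else 0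
  enum′ : ∀ w → Fin (count′ w) ↔ fibre (λ _ → u) w
  enum′ (i , j , k , l) with i ℕ.≟ p | j ℕ.≟ q | k ℕ.≟ r | l ℕ.≟ s
  ... | yes refl | yes refl | yes refl | yes refl =
    mk↔ₛ′ (λ _ → tt , refl) (λ _ → Fin.zero) (λ _ → fibre-≡ refl) (λ { Fin.zero → refl ; (Fin.suc ()) })
  ... | no i≢p | _ | _ | _ = Fin0↔ λ (_ , u≡w) → i≢p (sym (cong proj₁ u≡w))
  ... | yes _ | no j≢q | _ | _ = Fin0↔ λ (_ , u≡w) → j≢q (sym (cong (proj₁ ∘ proj₂) u≡w))
  ... | yes _ | yes _ | no k≢r | _ = Fin0↔ λ (_ , u≡w) → k≢r (sym (cong (proj₁ ∘ proj₂ ∘ proj₂) u≡w))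
  ... | yes _ | yes _ | yes _ | no l≢s = Fin0↔ λ (_ , u≡w) → l≢s (sym (cong (proj₂ ∘ proj₂ ∘ proj₂) u≡w))

infixr 5 _⊎ᶜ_
infixr 6 _×ᶜ_

_⊎ᶜ_ : Class → Class → Class
A ⊎ᶜ B = record
  { Obj    = Obj A ⊎ Obj B
  ; weight = [ weight A , weight B ]
  ; count  = λ w → count A w + count B w
  ; enum   = λ w → ↔-trans +↔⊎ (↔-trans (enum A w ⊎-↔ enum B w) (↔-sym Σ-distribʳ-⊎))
  }

splitting : {X Y : Set} (f : X → Weight) (g : Y → Weight) (w : Weight) →
            Σ≤ʷ (λ v → fibre f v × fibre g (w ∸ʷ v)) w ↔ fibre (λ (x , y) → f x +ʷ g y) w
splitting f g w = mk↔ₛ′ join split (λ _ → fibre-≡ refl) split∘join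
  where
  join : Σ≤ʷ (λ v → fibre f v × fibre g (w ∸ʷ v)) w → fibre (λ (x , y) → f x +ʷ g y) w
  join (v , v≤w , (x , refl) , (y , gy≡w∸v)) =
    (x , y) , trans (cong (f x +ʷ_) gy≡w∸v) (+ʷ-∸ʷ v≤w)
  split : fibre (λ (x , y) → f x +ʷ g y) w → Σ≤ʷ (λ v → fibre f v × fibre g (w ∸ʷ v)) w
  split ((x , y) , fx+gy≡w) = let fx≤w , gy≡w∸fx = +ʷ-split (f x) (g y) fx+gy≡w in
    f x , fx≤w , (x , refl) , (y , gy≡w∸fx)
  split∘join : ∀ z → split (join z) ≡ z
  split∘join (v , v≤w , (x , refl) , (y , _)) =
    cong₂ (λ le eq → v , le , (x , refl) , (y , eq)) (≤ʷ-irrelevant _ _) (uip _ _)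

_×ᶜ_ : Class → Class → Class
A ×ᶜ B = record
  { Obj    = Obj A × Obj B
  ; weight = λ (x , y) → weight A x +ʷ weight B y
  ; count  = λ w → ∑≤ʷ w λ v → count A v * count B (w ∸ʷ v)
  ; enum   = λ w → ↔-trans (Fin-∑≤ʷ w λ v → ↔-trans *↔× (enum A v ×-↔ enum B (w ∸ʷ v)))
                           (splitting (weight A) (weight B) w)
  }

Graded : (ℕ → Class) → Set
Graded S = ∀ n x → n ≤ ∣ weight (S n) x ∣ʷ

⨄ᶜ : (S : ℕ → Class) → Graded S → Class
⨄ᶜ S graded = record
  { Obj    = Σ ℕ (Obj ∘ S)
  ; weight = λ (n , x) → weight (S n) x
  ; count  = λ w → ∑≤ ∣ w ∣ʷ λ n → count (S n) w
  ; enum   = λ w → ↔-trans (Fin-∑≤ ∣ w ∣ʷ λ n → enum (S n) w) (mk↔ₛ′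
      (λ (n , _ , x , e) → (n , x) , e)
      (λ ((n , x) , e) → n , subst (λ v → n ≤ ∣ v ∣ʷ) e (graded n x) , x , e)
      (λ _ → refl)
      (λ (n , _ , x , e) → cong (λ le → n , le , x , e) (≤-irrelevant _ _)))
  }

∏ᶜ : ℕ → (ℕ → Class) → Class
∏ᶜ zero    S = monomialᶜ 0ʷ
∏ᶜ (suc n) S = ∏ᶜ n S ×ᶜ S n

relabel : (C : Class) {X : Set} → X ↔ Obj C → Class
relabel C {X} e = record
  { Obj    = X
  ; weight = weight C ∘ to e
  ; count  = count C
  ; enum   = λ w → ↔-trans (enum C w) (↔-sym (fibre-↔ e (λ _ → refl) w))
  }

multiples-graded : ∀ u → 1 ≤ ∣ u ∣ʷ → Graded (λ t → monomialᶜ (t ·ʷ u))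
multiples-graded u 1≤∣u∣ t _ =
  subst (t ≤_) (sym (∣·ʷ∣ t u)) (≤-trans (≤-reflexive (sym (*-identityʳ t))) (*-monoʳ-≤ t 1≤∣u∣))

geometricᶜ : (u : Weight) → 1 ≤ ∣ u ∣ʷ → Class
geometricᶜ u 1≤∣u∣ =
  relabel (⨄ᶜ (λ t → monomialᶜ (t ·ʷ u)) (multiples-graded u 1≤∣u∣))
          (mk↔ₛ′ (_, tt) proj₁ (λ _ → refl) (λ _ → refl))

Bool↔⊤⊎⊤ : Bool ↔ (⊤ ⊎ ⊤)
Bool↔⊤⊎⊤ = mk↔ₛ′ (λ { false → inj₁ tt ; true → inj₂ tt }) [ (λ _ → false) , (λ _ → true) ]
                 (λ { (inj₁ tt) → refl ; (inj₂ tt) → refl }) (λ { false → refl ; true → refl })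

binaryᶜ : Weight → Weight → Class
binaryᶜ u v = relabel (monomialᶜ u ⊎ᶜ monomialᶜ v) Bool↔⊤⊎⊤

IsGF : FPS → Class → Set
IsGF f C = ∀ w → coeff f w ≡ + count C w

-- prodInf f is truncated at a length depending on the monomial, so it agrees with one finite
-- product only on the monomials dividing a given one.
AgreeOn : Weight → FPS → Class → Set
AgreeOn w f C = ∀ v → v ≤ʷ w → coeff f v ≡ + count C v

+-if : ∀ b → + (if b then 1 else 0) ≡ (if b then + 1 else + 0)
+-if true  = refl
+-if false = refl

monomial-isGF : ∀ u → IsGF (monʷ u) (monomialᶜ u)
monomial-isGF (p , q , r , s) (i , j , k , l) =
  sym (+-if (⌊ i ℕ.≟ p ⌋ ∧ ⌊ j ℕ.≟ q ⌋ ∧ ⌊ k ℕ.≟ r ⌋ ∧ ⌊ l ℕ.≟ s ⌋))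

⊕-isGF : ∀ {f g} A B → IsGF f A → IsGF g B → IsGF (f ⊕ g) (A ⊎ᶜ B)
⊕-isGF A B f≐A g≐B w = cong₂ ℤ._+_ (f≐A w) (g≐B w)

⊛-agree : ∀ {w f g} A B → AgreeOn w f A → AgreeOn w g B → AgreeOn w (f ⊛ g) (A ×ᶜ B)
⊛-agree {w} {f} {g} A B f≐A g≐B v v≤w = begin
  sumToʷ v (λ u → coeff f u ℤ.* coeff g (v ∸ʷ u))
    ≡⟨ sumToʷ-cong v (λ u u≤v → trans
         (cong₂ ℤ._*_ (f≐A u (≤ʷ-trans u≤v v≤w)) (g≐B (v ∸ʷ u) (≤ʷ-trans (∸ʷ-≤ʷ v u) v≤w)))
         (sym (ℤ.pos-* (count A u) (count B (v ∸ʷ u))))) ⟩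
  sumToʷ v (λ u → + (count A u * count B (v ∸ʷ u)))
    ≡⟨ sumToʷ-+ v _ ⟩
  + count (A ×ᶜ B) v ∎
  where open ≡-Reasoning

⊛-isGF : ∀ {f g} A B → IsGF f A → IsGF g B → IsGF (f ⊛ g) (A ×ᶜ B)
⊛-isGF {f} {g} A B f≐A g≐B w =
  ⊛-agree {w} {f} {g} A B (λ v _ → f≐A v) (λ v _ → g≐B v) w ≤ʷ-refl

sumInf-isGF : ∀ {f} S (graded : Graded S) → (∀ n → IsGF (f n) (S n)) → IsGF (sumInf f) (⨄ᶜ S graded)
sumInf-isGF {f} S _ f≐S w =
  trans (sumTo-cong ∣ w ∣ʷ (λ n _ → f≐S n w)) (sumTo-+ ∣ w ∣ʷ (λ n → count (S n) w))

prodBelow-isGF : ∀ n {f} S → (∀ m → IsGF (f m) (S m)) → IsGF (prodBelow n f) (∏ᶜ n S)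
prodBelow-isGF zero    S f≐S = monomial-isGF 0ʷ
prodBelow-isGF (suc n) S f≐S = ⊛-isGF (∏ᶜ n S) (S n) (prodBelow-isGF n S f≐S) (f≐S n)

geom-isGF : ∀ p q r s (1≤deg : 1 ≤ deg p q r s) → IsGF (geom p q r s) (geometricᶜ (p , q , r , s) 1≤deg)
geom-isGF p q r s 1≤deg =
  sumInf-isGF (λ t → monomialᶜ (t ·ʷ (p , q , r , s))) (multiples-graded (p , q , r , s) 1≤deg)
    λ t → monomial-isGF (t ·ʷ (p , q , r , s))

binary-isGF : ∀ u v → IsGF (monʷ u ⊕ monʷ v) (binaryᶜ u v)
binary-isGF u v = ⊕-isGF (monomialᶜ u) (monomialᶜ v) (monomial-isGF u) (monomial-isGF v)

-- Convergent infinite products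

record ConvergentFactors (S : ℕ → Class) : Set where
  field
    unit         : ∀ m → Obj (S m)
    unit-weight  : ∀ m → weight (S m) (unit m) ≡ 0ʷ
    unit-or-deep : ∀ m x → x ≡ unit m ⊎ m < ∣ weight (S m) x ∣ʷ

module _ {S : ℕ → Class} (conv : ConvergentFactors S) where
  open ConvergentFactors conv

  ∏ᶜ-suc-fibre : ∀ {m} w → ∣ w ∣ʷ ≤ m → Fibre (∏ᶜ (suc m) S) w ↔ Fibre (∏ᶜ m S) w
  ∏ᶜ-suc-fibre {m} w ∣w∣≤m = mk↔ₛ′ drop (λ (x , e) → (x , unit m) , pad e)
    (λ _ → fibre-≡ refl) pad∘drop
    where
    small : ∀ x y → weight (∏ᶜ m S) x +ʷ weight (S m) y ≡ w → ¬ m < ∣ weight (S m) y ∣ʷ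
    small x y e m<∣y∣ = <⇒≱ m<∣y∣ (begin
      ∣ weight (S m) y ∣ʷ              ≤⟨ m≤n+m _ ∣ weight (∏ᶜ m S) x ∣ʷ ⟩
      ∣ weight (∏ᶜ m S) x ∣ʷ + ∣ weight (S m) y ∣ʷ
                                       ≡⟨ sym (∣+ʷ∣ (weight (∏ᶜ m S) x) (weight (S m) y)) ⟩
      ∣ weight (∏ᶜ m S) x +ʷ weight (S m) y ∣ʷ ≡⟨ cong ∣_∣ʷ e ⟩
      ∣ w ∣ʷ                           ≤⟨ ∣w∣≤m ⟩
      m                                ∎)
      where open ≤-Reasoning
    isUnit : ∀ x y → weight (∏ᶜ m S) x +ʷ weight (S m) y ≡ w → y ≡ unit m
    isUnit x y e with unit-or-deep m y
    ... | inj₁ y≡unit = y≡unit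
    ... | inj₂ deep   = contradiction deep (small x y e)
    +ʷunit : ∀ u → u +ʷ weight (S m) (unit m) ≡ u
    +ʷunit u = trans (cong (u +ʷ_) (unit-weight m)) (+ʷ-identityʳ u)
    pad : ∀ {x} → weight (∏ᶜ m S) x ≡ w → weight (∏ᶜ m S) x +ʷ weight (S m) (unit m) ≡ w
    pad e = trans (+ʷunit _) e
    drop : Fibre (∏ᶜ (suc m) S) w → Fibre (∏ᶜ m S) w
    drop ((x , y) , e) =
      x , trans (sym (+ʷunit _)) (subst (λ z → _ +ʷ weight (S m) z ≡ w) (isUnit x y e) e)
    pad∘drop : ∀ z → ((proj₁ (proj₁ z) , unit m) , pad (proj₂ (drop z))) ≡ z
    pad∘drop ((x , y) , e) with isUnit x y e
    ... | refl = fibre-≡ refl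

  count-∏ᶜ-stable : ∀ w {M N} → ∣ w ∣ʷ < M → M ≤′ N → count (∏ᶜ N S) w ≡ count (∏ᶜ M S) w
  count-∏ᶜ-stable w ∣w∣<M ≤′-refl = refl
  count-∏ᶜ-stable w {M} {suc N} ∣w∣<M (≤′-step M≤′N) =
    trans (count-≡ (∏ᶜ (suc N) S) (∏ᶜ N S) (∏ᶜ-suc-fibre w (≤-trans (<⇒≤ ∣w∣<M) (≤′⇒≤ M≤′N))))
          (count-∏ᶜ-stable w ∣w∣<M M≤′N)

  prodInf-agree : ∀ {f} → (∀ m → IsGF (f m) (S m)) → ∀ w → AgreeOn w (prodInf f) (∏ᶜ (suc ∣ w ∣ʷ) S)
  prodInf-agree f≐S w v v≤w =
    trans (prodBelow-isGF (suc ∣ v ∣ʷ) S f≐S v)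
          (cong +_ (sym (count-∏ᶜ-stable v ≤-refl (≤⇒≤′ (s≤s (∣∣ʷ-mono v≤w))))))

Q^_ abQ^_ abcQ^_ : ℕ → Weight
Q^ n    = (n , n , n , n)
abQ^ i  = (suc i , suc i , i , i)
abcQ^ i = (suc i , suc i , suc i , i)

γᶜ qᶜ αᶜ βᶜ : ℕ → Class
γᶜ i = binaryᶜ 0ʷ (abcQ^ i)
qᶜ i = binaryᶜ (Q^ 1) (abcQ^ i)
αᶜ i = geometricᶜ (abQ^ i) (s≤s z≤n)
βᶜ i = geometricᶜ (Q^ suc i) (s≤s z≤n)

productᶜ : ℕ → Class
productᶜ M = (∏ᶜ M γᶜ ×ᶜ ∏ᶜ M αᶜ) ×ᶜ ∏ᶜ M βᶜ

abQⁿᶜ : ℕ → Class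
abQⁿᶜ n = monomialᶜ (1 , 1 , 0 , 0) ×ᶜ monomialᶜ (Q^ n)

term1ᶜ term2ᶜ : ℕ → Class
term1ᶜ n = (∏ᶜ n qᶜ ×ᶜ ∏ᶜ n αᶜ) ×ᶜ ∏ᶜ n βᶜ
term2ᶜ n = ((abQⁿᶜ n ×ᶜ ∏ᶜ n γᶜ) ×ᶜ ∏ᶜ (suc n) αᶜ) ×ᶜ ∏ᶜ n βᶜ

∏ᶜ-graded : ∀ {S} → (∀ m x → 1 ≤ ∣ weight (S m) x ∣ʷ) → Graded (λ n → ∏ᶜ n S)
∏ᶜ-graded 1≤∣S∣ zero    _       = z≤n
∏ᶜ-graded {S} 1≤∣S∣ (suc n) (x , y) = begin
  suc n                                              ≡⟨ +-comm 1 n ⟩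
  n + 1                                              ≤⟨ +-mono-≤ (∏ᶜ-graded 1≤∣S∣ n x) (1≤∣S∣ n y) ⟩
  ∣ weight (∏ᶜ n S) x ∣ʷ + ∣ weight (S n) y ∣ʷ       ≡⟨ sym (∣+ʷ∣ (weight (∏ᶜ n S) x) _) ⟩
  ∣ weight (∏ᶜ n S) x +ʷ weight (S n) y ∣ʷ           ∎
  where open ≤-Reasoning

term1-graded : Graded term1ᶜ
term1-graded n ((q , a) , b) = begin
  n                    ≤⟨ ∏ᶜ-graded 1≤∣q∣ n q ⟩
  ∣ Qs ∣ʷ              ≤⟨ ∣∣ʷ-≤-+ʷ Qs As ⟩
  ∣ Qs +ʷ As ∣ʷ        ≤⟨ ∣∣ʷ-≤-+ʷ (Qs +ʷ As) Bs ⟩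
  ∣ Qs +ʷ As +ʷ Bs ∣ʷ  ∎
  where
  open ≤-Reasoning
  Qs = weight (∏ᶜ n qᶜ) q
  As = weight (∏ᶜ n αᶜ) a
  Bs = weight (∏ᶜ n βᶜ) b
  1≤∣q∣ : ∀ m x → 1 ≤ ∣ weight (qᶜ m) x ∣ʷ
  1≤∣q∣ m false = s≤s z≤n
  1≤∣q∣ m true  = s≤s z≤n

term2-graded : Graded term2ᶜ
term2-graded n (((_ , g) , a) , b) = begin
  n                                ≤⟨ <⇒≤ head≤∣∣ʷ ⟩
  ∣ abQ^ n ∣ʷ                      ≤⟨ ∣∣ʷ-≤-+ʷ (abQ^ n) Gs ⟩
  ∣ abQ^ n +ʷ Gs ∣ʷ                ≤⟨ ∣∣ʷ-≤-+ʷ (abQ^ n +ʷ Gs) As ⟩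
  ∣ abQ^ n +ʷ Gs +ʷ As ∣ʷ          ≤⟨ ∣∣ʷ-≤-+ʷ (abQ^ n +ʷ Gs +ʷ As) Bs ⟩
  ∣ abQ^ n +ʷ Gs +ʷ As +ʷ Bs ∣ʷ    ∎
  where
  open ≤-Reasoning
  Gs = weight (∏ᶜ n γᶜ) g
  As = weight (∏ᶜ (suc n) αᶜ) a
  Bs = weight (∏ᶜ n βᶜ) b

middleᶜ : Class
middleᶜ = ⨄ᶜ term1ᶜ term1-graded ⊎ᶜ ⨄ᶜ term2ᶜ term2-graded

γ-isGF : ∀ i → IsGF (one ⊕ mon (suc i) (suc i) (suc i) i) (γᶜ i)
γ-isGF i = binary-isGF 0ʷ (abcQ^ i)

q-isGF : ∀ i → IsGF (Qpow 1 ⊕ mon (suc i) (suc i) (suc i) i) (qᶜ i)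
q-isGF i = binary-isGF (Q^ 1) (abcQ^ i)

α-isGF : ∀ i → IsGF (geom (suc i) (suc i) i i) (αᶜ i)
α-isGF i = geom-isGF (suc i) (suc i) i i (s≤s z≤n)

β-isGF : ∀ i → IsGF (geom (suc i) (suc i) (suc i) (suc i)) (βᶜ i)
β-isGF i = geom-isGF (suc i) (suc i) (suc i) (suc i) (s≤s z≤n)

term1-isGF : ∀ n → IsGF (term1 n) (term1ᶜ n)
term1-isGF n =
  ⊛-isGF (∏ᶜ n qᶜ ×ᶜ ∏ᶜ n αᶜ) (∏ᶜ n βᶜ)
    (⊛-isGF (∏ᶜ n qᶜ) (∏ᶜ n αᶜ) (prodBelow-isGF n qᶜ q-isGF) (prodBelow-isGF n αᶜ α-isGF))
    (prodBelow-isGF n βᶜ β-isGF)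

term2-isGF : ∀ n → IsGF (term2 n) (term2ᶜ n)
term2-isGF n =
  ⊛-isGF ((abQⁿᶜ n ×ᶜ ∏ᶜ n γᶜ) ×ᶜ ∏ᶜ (suc n) αᶜ) (∏ᶜ n βᶜ)
    (⊛-isGF (abQⁿᶜ n ×ᶜ ∏ᶜ n γᶜ) (∏ᶜ (suc n) αᶜ)
      (⊛-isGF (abQⁿᶜ n) (∏ᶜ n γᶜ)
        (⊛-isGF (monomialᶜ (1 , 1 , 0 , 0)) (monomialᶜ (Q^ n))
          (monomial-isGF (1 , 1 , 0 , 0)) (monomial-isGF (Q^ n)))
        (prodBelow-isGF n γᶜ γ-isGF))
      (prodBelow-isGF (suc n) αᶜ α-isGF))
    (prodBelow-isGF n βᶜ β-isGF)

middle-isGF : IsGF middleSeries middleᶜ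
middle-isGF =
  ⊕-isGF (⨄ᶜ term1ᶜ term1-graded) (⨄ᶜ term2ᶜ term2-graded)
    (sumInf-isGF term1ᶜ term1-graded term1-isGF) (sumInf-isGF term2ᶜ term2-graded term2-isGF)

binary-convergent : (v : ℕ → Weight) → (∀ m → m < ∣ v m ∣ʷ) → ConvergentFactors (λ m → binaryᶜ 0ʷ (v m))
binary-convergent v m<∣v∣ = record
  { unit         = λ _ → false
  ; unit-weight  = λ _ → refl
  ; unit-or-deep = λ { m false → inj₁ refl ; m true → inj₂ (m<∣v∣ m) }
  }

geometric-convergent : (u : ℕ → Weight) (1≤∣u∣ : ∀ m → 1 ≤ ∣ u m ∣ʷ) → (∀ m → m < ∣ u m ∣ʷ) →
                       ConvergentFactors (λ m → geometricᶜ (u m) (1≤∣u∣ m))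
geometric-convergent u _ m<∣u∣ = record
  { unit         = λ _ → 0
  ; unit-weight  = λ _ → refl
  ; unit-or-deep = λ { m zero → inj₁ refl ; m (suc t) → inj₂ (deep m t) }
  }
  where
  deep : ∀ m t → m < ∣ suc t ·ʷ u m ∣ʷ
  deep m t =
    <-≤-trans (m<∣u∣ m) (≤-trans (m≤m+n _ (t * ∣ u m ∣ʷ)) (≤-reflexive (sym (∣·ʷ∣ (suc t) (u m)))))

productSeries-agree : ∀ w → AgreeOn w productSeries (productᶜ (suc ∣ w ∣ʷ))
productSeries-agree w =
  ⊛-agree (∏ᶜ M γᶜ ×ᶜ ∏ᶜ M αᶜ) (∏ᶜ M βᶜ)
    (⊛-agree (∏ᶜ M γᶜ) (∏ᶜ M αᶜ)
      (prodInf-agree (binary-convergent abcQ^_ (λ _ → head≤∣∣ʷ)) γ-isGF w)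
      (prodInf-agree (geometric-convergent abQ^_ _ (λ _ → head≤∣∣ʷ)) α-isGF w))
    (prodInf-agree (geometric-convergent (λ i → Q^ suc i) _ (λ _ → head≤∣∣ʷ)) β-isGF w)
  where M = suc ∣ w ∣ʷ

-- Sequences of triples

indexedSum : {X : Set} → (ℕ → X → Weight) → ℕ → List X → Weight
indexedSum f i []       = 0ʷ
indexedSum f i (x ∷ xs) = f i x +ʷ indexedSum f (suc i) xs

indexedSum-∷ʳ : ∀ {X : Set} (f : ℕ → X → Weight) i xs x →
                indexedSum f i (xs ++ x ∷ []) ≡ indexedSum f i xs +ʷ f (i + length xs) x
indexedSum-∷ʳ f i []       x = trans (+ʷ-identityʳ (f i x)) (cong (λ k → f k x) (sym (+-identityʳ i)))
indexedSum-∷ʳ f i (y ∷ xs) x = begin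
  f i y +ʷ indexedSum f (suc i) (xs ++ x ∷ [])
    ≡⟨ cong (f i y +ʷ_) (indexedSum-∷ʳ f (suc i) xs x) ⟩
  f i y +ʷ (indexedSum f (suc i) xs +ʷ f (suc i + length xs) x)
    ≡⟨ sym (+ʷ-assoc (f i y) (indexedSum f (suc i) xs) (f (suc i + length xs) x)) ⟩
  f i y +ʷ indexedSum f (suc i) xs +ʷ f (suc i + length xs) x
    ≡⟨ cong (λ k → f i y +ʷ indexedSum f (suc i) xs +ʷ f k x) (sym (+-suc i (length xs))) ⟩
  f i y +ʷ indexedSum f (suc i) xs +ʷ f (i + suc (length xs)) x ∎
  where open ≡-Reasoning

module Words {X : Set} (S : ℕ → Class) (toX : ∀ i → Obj (S i) ↔ X) where

  letterWeight : ℕ → X → Weight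
  letterWeight i x = weight (S i) (from (toX i) x)

  wordWeight : ∀ {n} → Vec X n → Weight
  wordWeight xs = indexedSum letterWeight 0 (toList xs)

  toWord : ∀ n → Obj (∏ᶜ n S) → Vec X n
  toWord zero    _       = []
  toWord (suc n) (p , x) = toWord n p ∷ʳ to (toX n) x

  fromWord : ∀ n → Vec X n → Obj (∏ᶜ n S)
  fromWord zero    _  = tt
  fromWord (suc n) xs = fromWord n (init xs) , from (toX n) (last xs)

  ∏ᶜ↔Vec : ∀ n → Obj (∏ᶜ n S) ↔ Vec X n
  ∏ᶜ↔Vec n = mk↔ₛ′ (toWord n) (fromWord n) (to∘from n) (from∘to n)
    where
    to∘from : ∀ n xs → toWord n (fromWord n xs) ≡ xs
    to∘from zero    []       = refl
    to∘from (suc n) xs = begin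
      toWord n (fromWord n (init xs)) ∷ʳ to (toX n) (from (toX n) (last xs))
        ≡⟨ cong₂ _∷ʳ_ (to∘from n (init xs)) (strictlyInverseˡ (toX n) (last xs)) ⟩
      init xs ∷ʳ last xs
        ≡⟨ sym (proj₂ (proj₂ (Vec.initLast xs))) ⟩
      xs ∎
      where open ≡-Reasoning
    from∘to : ∀ n p → fromWord n (toWord n p) ≡ p
    from∘to zero    tt      = refl
    from∘to (suc n) (p , x) = cong₂ _,_
      (trans (cong (fromWord n) (Vec.init-∷ʳ _ (toWord n p))) (from∘to n p))
      (trans (cong (from (toX n)) (Vec.last-∷ʳ _ (toWord n p))) (strictlyInverseʳ (toX n) x))

  wordWeight-∷ʳ : ∀ {n} (xs : Vec X n) x → wordWeight (xs ∷ʳ x) ≡ wordWeight xs +ʷ letterWeight n x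
  wordWeight-∷ʳ {n} xs x = begin
    indexedSum letterWeight 0 (toList (xs ∷ʳ x))
      ≡⟨ cong (indexedSum letterWeight 0) (Vec.toList-∷ʳ x xs) ⟩
    indexedSum letterWeight 0 (toList xs ++ x ∷ [])
      ≡⟨ indexedSum-∷ʳ letterWeight 0 (toList xs) x ⟩
    wordWeight xs +ʷ letterWeight (length (toList xs)) x
      ≡⟨ cong (λ k → wordWeight xs +ʷ letterWeight k x) (Vec.length-toList xs) ⟩
    wordWeight xs +ʷ letterWeight n x ∎
    where open ≡-Reasoning

  wordWeight-toWord : ∀ n p → wordWeight (toWord n p) ≡ weight (∏ᶜ n S) p
  wordWeight-toWord zero    tt      = refl
  wordWeight-toWord (suc n) (p , x) =
    trans (wordWeight-∷ʳ (toWord n p) (to (toX n) x))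
          (cong₂ _+ʷ_ (wordWeight-toWord n p) (cong (weight (S n)) (strictlyInverseʳ (toX n) x)))

zip↔ : ∀ {A B : Set} {n} → (Vec A n × Vec B n) ↔ Vec (A × B) n
zip↔ = mk↔ₛ′ (uncurry zip) unzip zip∘unzip (uncurry unzip∘zip)
  where
  zip∘unzip : ∀ {A B : Set} {n} (xys : Vec (A × B) n) → uncurry zip (unzip xys) ≡ xys
  zip∘unzip []             = refl
  zip∘unzip ((x , y) ∷ xys) = cong ((x , y) ∷_) (zip∘unzip xys)
  unzip∘zip : ∀ {A B : Set} {n} (xs : Vec A n) (ys : Vec B n) → unzip (zip xs ys) ≡ (xs , ys)
  unzip∘zip []       []       = refl
  unzip∘zip (x ∷ xs) (y ∷ ys) = cong (λ (xs′ , ys′) → x ∷ xs′ , y ∷ ys′) (unzip∘zip xs ys)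

Triple : Set
Triple = Bool × ℕ × ℕ

tripleWeight : ℕ → Triple → Weight
tripleWeight i (g , a , b) = weight (γᶜ i) g +ʷ weight (αᶜ i) a +ʷ weight (βᶜ i) b

module γWords = Words γᶜ (λ _ → ↔-refl)
module αWords = Words αᶜ (λ _ → ↔-refl)
module βWords = Words βᶜ (λ _ → ↔-refl)
module qWords = Words qᶜ (λ _ → ↔-refl)

triples : ∀ {n} → Vec Bool n → Vec ℕ n → Vec ℕ n → Vec Triple n
triples gs as bs = zip gs (zip as bs)

triples↔ : ∀ {n} → ((Vec Bool n × Vec ℕ n) × Vec ℕ n) ↔ Vec Triple n
triples↔ = ↔-trans (mk↔ₛ′ (λ ((gs , as) , bs) → gs , as , bs) (λ (gs , as , bs) → (gs , as) , bs)
                           (λ _ → refl) (λ _ → refl))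
                   (↔-trans (↔-refl ×-↔ zip↔) zip↔)

indexedSum-triples : ∀ i {n} (gs : Vec Bool n) (as bs : Vec ℕ n) →
  indexedSum tripleWeight i (toList (triples gs as bs)) ≡
  indexedSum (λ i → weight (γᶜ i)) i (toList gs) +ʷ indexedSum (λ i → weight (αᶜ i)) i (toList as)
    +ʷ indexedSum (λ i → weight (βᶜ i)) i (toList bs)
indexedSum-triples i []       []       []       = refl
indexedSum-triples i (g ∷ gs) (a ∷ as) (b ∷ bs) =
  trans (cong (tripleWeight i (g , a , b) +ʷ_) (indexedSum-triples (suc i) gs as bs))
        (solve 6 (λ g a b G A B → ((g ∙ a) ∙ b) ∙ ((G ∙ A) ∙ B) ⊜ ((g ∙ G) ∙ (a ∙ A)) ∙ (b ∙ B)) refl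
           (weight (γᶜ i) g) (weight (αᶜ i) a) (weight (βᶜ i) b)
           (indexedSum (λ i → weight (γᶜ i)) (suc i) (toList gs))
           (indexedSum (λ i → weight (αᶜ i)) (suc i) (toList as))
           (indexedSum (λ i → weight (βᶜ i)) (suc i) (toList bs)))
  where open +ʷ-Solver using (solve; _⊜_) renaming (_⊕_ to _∙_)

product↔triples : ∀ M → Obj (productᶜ M) ↔ Vec Triple M
product↔triples M = ↔-trans ((γWords.∏ᶜ↔Vec M ×-↔ αWords.∏ᶜ↔Vec M) ×-↔ βWords.∏ᶜ↔Vec M) triples↔

product-weight : ∀ M x →
  indexedSum tripleWeight 0 (toList (to (product↔triples M) x)) ≡ weight (productᶜ M) x
product-weight M ((g , a) , b) =
  trans (indexedSum-triples 0 (γWords.toWord M g) (αWords.toWord M a) (βWords.toWord M b))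
        (cong₂ _+ʷ_ (cong₂ _+ʷ_ (γWords.wordWeight-toWord M g) (αWords.wordWeight-toWord M a))
                    (βWords.wordWeight-toWord M b))

-- The last nonzero triple: the partition of an oddEnd sequence has an odd number of parts.
data LastTriple : Set where
  oddEnd  : ℕ → LastTriple
  evenEnd : Bool → ℕ → ℕ → LastTriple

⌜_⌝ : LastTriple → Triple
⌜ oddEnd a          ⌝ = false , suc a , 0
⌜ evenEnd false a b ⌝ = false , a , suc b
⌜ evenEnd true  a b ⌝ = true , a , b

data FinSupp : Set where
  empty : FinSupp
  _▷_   : ∀ {n} → Vec Triple n → LastTriple → FinSupp

elements : FinSupp → List Triple
elements empty    = []
elements (ts ▷ z) = toList ts ++ ⌜ z ⌝ ∷ []

weightᶠ : FinSupp → Weight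
weightᶠ s = indexedSum tripleWeight 0 (elements s)

weightᶠ-▷ : ∀ {n} (ts : Vec Triple n) z →
  weightᶠ (ts ▷ z) ≡ indexedSum tripleWeight 0 (toList ts) +ʷ tripleWeight n ⌜ z ⌝
weightᶠ-▷ {n} ts z =
  trans (indexedSum-∷ʳ tripleWeight 0 (toList ts) ⌜ z ⌝)
        (cong (λ k → indexedSum tripleWeight 0 (toList ts) +ʷ tripleWeight k ⌜ z ⌝)
              (Vec.length-toList ts))

0ᵗ : Triple
0ᵗ = false , 0 , 0

⟪_⟫ : Triple → FinSupp
⟪ true  , a     , b     ⟫ = [] ▷ evenEnd true a b
⟪ false , a     , suc b ⟫ = [] ▷ evenEnd false a b
⟪ false , suc a , zero  ⟫ = [] ▷ oddEnd a
⟪ false , zero  , zero  ⟫ = empty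

⟪⟫-view : ∀ t → (t ≡ 0ᵗ × ⟪ t ⟫ ≡ empty) ⊎ elements ⟪ t ⟫ ≡ t ∷ []
⟪⟫-view (true  , a     , b)     = inj₂ refl
⟪⟫-view (false , a     , suc b) = inj₂ refl
⟪⟫-view (false , suc a , zero)  = inj₂ refl
⟪⟫-view (false , zero  , zero)  = inj₁ (refl , refl)

infixr 5 _◁_
_◁_ : Triple → FinSupp → FinSupp
t ◁ empty    = ⟪ t ⟫
t ◁ (ts ▷ z) = (t ∷ ts) ▷ z

trim : List Triple → FinSupp
trim = List.foldr _◁_ empty

pad : (M : ℕ) → List Triple → Vec Triple M
pad zero    _        = []
pad (suc M) []       = 0ᵗ ∷ pad M []
pad (suc M) (t ∷ ts) = t ∷ pad M ts

trim-elements : ∀ s → trim (elements s) ≡ s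
trim-elements empty    = refl
trim-elements (ts ▷ z) = go ts z
  where
  go : ∀ {n} (ts : Vec Triple n) z → trim (toList ts ++ ⌜ z ⌝ ∷ []) ≡ ts ▷ z
  go []       (oddEnd a)          = refl
  go []       (evenEnd false a b) = refl
  go []       (evenEnd true  a b) = refl
  go (t ∷ ts) z                   = cong (t ◁_) (go ts z)

pad-trim : ∀ M l → pad M (elements (trim l)) ≡ pad M l
pad-trim zero    l        = refl
pad-trim (suc M) []       = refl
pad-trim (suc M) (t ∷ ts) with trim ts | pad-trim M ts
... | _ ▷ _ | ih = cong (t ∷_) ih
... | empty | ih with ⟪⟫-view t
...   | inj₁ (refl , ⟪t⟫≡empty) rewrite ⟪t⟫≡empty = cong (0ᵗ ∷_) ih
...   | inj₂ elements⟪t⟫≡[t]   rewrite elements⟪t⟫≡[t] = cong (t ∷_) ih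

indexedSum-trim : ∀ i l → indexedSum tripleWeight i (elements (trim l)) ≡ indexedSum tripleWeight i l
indexedSum-trim i []       = refl
indexedSum-trim i (t ∷ ts) with trim ts | indexedSum-trim (suc i) ts
... | _ ▷ _ | ih = cong (tripleWeight i t +ʷ_) ih
... | empty | ih with ⟪⟫-view t
...   | inj₁ (refl , ⟪t⟫≡empty) rewrite ⟪t⟫≡empty = ih
...   | inj₂ elements⟪t⟫≡[t]   rewrite elements⟪t⟫≡[t] = cong (tripleWeight i t +ʷ_) ih

pad-toList : ∀ {M} (v : Vec Triple M) → pad M (toList v) ≡ v
pad-toList []      = refl
pad-toList (t ∷ v) = cong (t ∷_) (pad-toList v)

trim-pad : ∀ M l → length l ≤ M → trim (toList (pad M l)) ≡ trim l
trim-pad zero    []       _          = refl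
trim-pad (suc M) []       _          rewrite trim-pad M [] z≤n = refl
trim-pad (suc M) (t ∷ ts) (s≤s ∣ts∣≤M) rewrite trim-pad M ts ∣ts∣≤M = refl

indexedSum-pad : ∀ M i l → length l ≤ M →
  indexedSum tripleWeight i (toList (pad M l)) ≡ indexedSum tripleWeight i l
indexedSum-pad zero    i []       _            = refl
indexedSum-pad (suc M) i []       _            = indexedSum-pad M (suc i) [] z≤n
indexedSum-pad (suc M) i (t ∷ ts) (s≤s ∣ts∣≤M) =
  cong (tripleWeight i t +ʷ_) (indexedSum-pad M (suc i) ts ∣ts∣≤M)

length-elements : ∀ s → length (elements s) ≤ ∣ weightᶠ s ∣ʷ
length-elements empty = z≤n
length-elements (_▷_ {n} ts z) = begin
  length (toList ts ++ ⌜ z ⌝ ∷ [])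
    ≡⟨ trans (List.length-++ (toList ts)) (trans (cong (_+ 1) (Vec.length-toList ts)) (+-comm n 1)) ⟩
  suc n
    ≤⟨ suc-≤-∣⌜z⌝∣ z ⟩
  ∣ tripleWeight n ⌜ z ⌝ ∣ʷ
    ≤⟨ m≤n+m _ ∣ indexedSum tripleWeight 0 (toList ts) ∣ʷ ⟩
  ∣ indexedSum tripleWeight 0 (toList ts) ∣ʷ + ∣ tripleWeight n ⌜ z ⌝ ∣ʷ
    ≡⟨ sym (∣+ʷ∣ (indexedSum tripleWeight 0 (toList ts)) (tripleWeight n ⌜ z ⌝)) ⟩
  ∣ indexedSum tripleWeight 0 (toList ts) +ʷ tripleWeight n ⌜ z ⌝ ∣ʷ
    ≡⟨ cong ∣_∣ʷ (sym (weightᶠ-▷ ts z)) ⟩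
  ∣ weightᶠ (ts ▷ z) ∣ʷ ∎
  where
  open ≤-Reasoning
  suc-≤-∣⌜z⌝∣ : ∀ z → suc n ≤ ∣ tripleWeight n ⌜ z ⌝ ∣ʷ
  suc-≤-∣⌜z⌝∣ (oddEnd a) =
    ≤-trans (≤-trans (m≤m+n (suc n) (a * suc n)) (m≤m+n _ 0)) head≤∣∣ʷ
  suc-≤-∣⌜z⌝∣ (evenEnd false a b) =
    ≤-trans (≤-trans (m≤m+n (suc n) (b * suc n)) (m≤n+m _ (a * suc n))) head≤∣∣ʷ
  suc-≤-∣⌜z⌝∣ (evenEnd true a b) =
    ≤-trans (≤-trans (m≤m+n (suc n) (a * suc n)) (m≤m+n _ (b * suc n))) head≤∣∣ʷ

trim-fibre : ∀ M w → ∣ w ∣ʷ < M → fibre (indexedSum tripleWeight 0 ∘ toList {n = M}) w ↔ fibre weightᶠ w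
trim-fibre M w ∣w∣<M = mk↔ₛ′
  (λ (ts , e) → trim (toList ts) , trans (indexedSum-trim 0 (toList ts)) e)
  (λ (s , e) → pad M (elements s) , trans (indexedSum-pad M 0 (elements s) (fits s e)) e)
  (λ (s , e) → fibre-≡ (trans (trim-pad M (elements s) (fits s e)) (trim-elements s)))
  (λ (ts , e) → fibre-≡ (trans (pad-trim M (toList ts)) (pad-toList ts)))
  where
  fits : ∀ s → weightᶠ s ≡ w → length (elements s) ≤ M
  fits s e = ≤-trans (length-elements s) (≤-trans (≤-reflexive (cong ∣_∣ʷ e)) (<⇒≤ ∣w∣<M))

product-fibre : ∀ M w → ∣ w ∣ʷ < M → Fibre (productᶜ M) w ↔ fibre weightᶠ w
product-fibre M w ∣w∣<M =
  ↔-trans (fibre-↔ (product↔triples M) (product-weight M) w) (trim-fibre M w ∣w∣<M)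

Term1Words Term2Words : ℕ → Set
Term1Words n = (Vec Bool n × Vec ℕ n) × Vec ℕ n
Term2Words n = (Vec Bool n × Vec ℕ (suc n)) × Vec ℕ n

MiddleWords : Set
MiddleWords = Σ ℕ Term1Words ⊎ Σ ℕ Term2Words

middleWordsWeight : MiddleWords → Weight
middleWordsWeight (inj₁ (n , (qs , as) , bs)) =
  qWords.wordWeight qs +ʷ αWords.wordWeight as +ʷ βWords.wordWeight bs
middleWordsWeight (inj₂ (n , (gs , as) , bs)) =
  abQ^ n +ʷ γWords.wordWeight gs +ʷ αWords.wordWeight as +ʷ βWords.wordWeight bs

middle↔words : Obj middleᶜ ↔ MiddleWords
middle↔words = Σ-↔ ↔-refl term1↔ ⊎-↔ Σ-↔ ↔-refl term2↔
  where
  term1↔ : ∀ {n} → Obj (term1ᶜ n) ↔ Term1Words n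
  term1↔ {n} = (qWords.∏ᶜ↔Vec n ×-↔ αWords.∏ᶜ↔Vec n) ×-↔ βWords.∏ᶜ↔Vec n
  term2↔ : ∀ {n} → Obj (term2ᶜ n) ↔ Term2Words n
  term2↔ {n} = ↔-trans
    (mk↔ₛ′ (λ ((((_ , _) , g) , a) , b) → (g , a) , b) (λ ((g , a) , b) → (((tt , tt) , g) , a) , b)
           (λ _ → refl) (λ _ → refl))
    ((γWords.∏ᶜ↔Vec n ×-↔ αWords.∏ᶜ↔Vec (suc n)) ×-↔ βWords.∏ᶜ↔Vec n)

middle-weight : ∀ x → middleWordsWeight (to middle↔words x) ≡ weight middleᶜ x
middle-weight (inj₁ (n , (q , a) , b)) =
  cong₂ _+ʷ_ (cong₂ _+ʷ_ (qWords.wordWeight-toWord n q) (αWords.wordWeight-toWord n a))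
             (βWords.wordWeight-toWord n b)
middle-weight (inj₂ (n , (((_ , _) , g) , a) , b)) =
  cong₂ _+ʷ_ (cong₂ _+ʷ_ (cong (abQ^ n +ʷ_) (γWords.wordWeight-toWord n g))
                         (αWords.wordWeight-toWord (suc n) a))
             (βWords.wordWeight-toWord n b)

evenEnd-weight : ∀ m q a b →
  tripleWeight m ⌜ evenEnd q a b ⌝ ≡ weight (qᶜ 0) q +ʷ Q^ m +ʷ weight (αᶜ m) a +ʷ weight (βᶜ m) b
evenEnd-weight m true  a b = refl
evenEnd-weight m false a b =
  solve 3 (λ α Q′ bQ′ → (id ∙ α) ∙ (Q′ ∙ bQ′) ⊜ (Q′ ∙ α) ∙ bQ′) refl
    (weight (αᶜ m) a) (Q^ suc m) (b ·ʷ Q^ suc m)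
  where open +ʷ-Solver using (solve; _⊜_; id) renaming (_⊕_ to _∙_)

oddEnd-weight : ∀ m a → tripleWeight m ⌜ oddEnd a ⌝ ≡ abQ^ m +ʷ weight (αᶜ m) a
oddEnd-weight m a = +ʷ-identityʳ (abQ^ m +ʷ weight (αᶜ m) a)

qᶜ-shift : ∀ i g → weight (qᶜ (suc i)) g ≡ Q^ 1 +ʷ weight (γᶜ i) g
qᶜ-shift i false = refl
qᶜ-shift i true  = refl

indexedSum-q-shift : ∀ i {n} (qs : Vec Bool n) →
  indexedSum (λ i → weight (qᶜ i)) (suc i) (toList qs) ≡
  Q^ n +ʷ indexedSum (λ i → weight (γᶜ i)) i (toList qs)
indexedSum-q-shift i []       = refl
indexedSum-q-shift i {suc n} (q ∷ qs) =
  trans (cong₂ _+ʷ_ (qᶜ-shift i q) (indexedSum-q-shift (suc i) qs))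
        (solve 4 (λ Q γ Qⁿ Γ → (Q ∙ γ) ∙ (Qⁿ ∙ Γ) ⊜ (Q ∙ Qⁿ) ∙ (γ ∙ Γ)) refl
           (Q^ 1) (weight (γᶜ i) q) (Q^ n) (indexedSum (λ i → weight (γᶜ i)) (suc i) (toList qs)))
  where open +ʷ-Solver using (solve; _⊜_) renaming (_⊕_ to _∙_)

evenEnd-middle-weight : ∀ {m} q (gs : Vec Bool m) as bs a b →
  weightᶠ (triples gs as bs ▷ evenEnd q a b) ≡
  middleWordsWeight (inj₁ (suc m , (q ∷ gs , as ∷ʳ a) , bs ∷ʳ b))
evenEnd-middle-weight {m} q gs as bs a b = begin
  weightᶠ (triples gs as bs ▷ evenEnd q a b)
    ≡⟨ weightᶠ-▷ (triples gs as bs) (evenEnd q a b) ⟩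
  indexedSum tripleWeight 0 (toList (triples gs as bs)) +ʷ tripleWeight m ⌜ evenEnd q a b ⌝
    ≡⟨ cong₂ _+ʷ_ (indexedSum-triples 0 gs as bs) (evenEnd-weight m q a b) ⟩
  Γ +ʷ A +ʷ B +ʷ (q₀ +ʷ Q^ m +ʷ α +ʷ β)
    ≡⟨ solve 7 (λ Γ A B q₀ Qᵐ α β →
                 ((Γ ∙ A) ∙ B) ∙ (((q₀ ∙ Qᵐ) ∙ α) ∙ β) ⊜ ((q₀ ∙ (Qᵐ ∙ Γ)) ∙ (A ∙ α)) ∙ (B ∙ β))
         refl Γ A B q₀ (Q^ m) α β ⟩
  q₀ +ʷ (Q^ m +ʷ Γ) +ʷ (A +ʷ α) +ʷ (B +ʷ β)
    ≡⟨ sym (cong₂ _+ʷ_ (cong₂ _+ʷ_ (cong (q₀ +ʷ_) (indexedSum-q-shift 0 gs))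
                                   (αWords.wordWeight-∷ʳ as a))
                        (βWords.wordWeight-∷ʳ bs b)) ⟩
  middleWordsWeight (inj₁ (suc m , (q ∷ gs , as ∷ʳ a) , bs ∷ʳ b)) ∎
  where
  open ≡-Reasoning
  open +ʷ-Solver using (solve; _⊜_) renaming (_⊕_ to _∙_)
  Γ = indexedSum (λ i → weight (γᶜ i)) 0 (toList gs)
  A = αWords.wordWeight as
  B = βWords.wordWeight bs
  q₀ = weight (qᶜ 0) q
  α = weight (αᶜ m) a
  β = weight (βᶜ m) b

oddEnd-middle-weight : ∀ {m} (gs : Vec Bool m) as bs a →
  weightᶠ (triples gs as bs ▷ oddEnd a) ≡ middleWordsWeight (inj₂ (m , (gs , as ∷ʳ a) , bs))
oddEnd-middle-weight {m} gs as bs a = begin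
  weightᶠ (triples gs as bs ▷ oddEnd a)
    ≡⟨ weightᶠ-▷ (triples gs as bs) (oddEnd a) ⟩
  indexedSum tripleWeight 0 (toList (triples gs as bs)) +ʷ tripleWeight m ⌜ oddEnd a ⌝
    ≡⟨ cong₂ _+ʷ_ (indexedSum-triples 0 gs as bs) (oddEnd-weight m a) ⟩
  Γ +ʷ A +ʷ B +ʷ (abQ^ m +ʷ α)
    ≡⟨ solve 5 (λ Γ A B abQᵐ α → ((Γ ∙ A) ∙ B) ∙ (abQᵐ ∙ α) ⊜ ((abQᵐ ∙ Γ) ∙ (A ∙ α)) ∙ B)
         refl Γ A B (abQ^ m) α ⟩
  abQ^ m +ʷ Γ +ʷ (A +ʷ α) +ʷ B
    ≡⟨ sym (cong (λ A′ → abQ^ m +ʷ Γ +ʷ A′ +ʷ B) (αWords.wordWeight-∷ʳ as a)) ⟩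
  middleWordsWeight (inj₂ (m , (gs , as ∷ʳ a) , bs)) ∎
  where
  open ≡-Reasoning
  open +ʷ-Solver using (solve; _⊜_) renaming (_⊕_ to _∙_)
  Γ = γWords.wordWeight gs
  A = αWords.wordWeight as
  B = βWords.wordWeight bs
  α = weight (αᶜ m) a

finSupp↔words : FinSupp ↔ MiddleWords
finSupp↔words = mk↔ₛ′ toWords fromWords to∘from from∘to
  where
  toWords : FinSupp → MiddleWords
  toWords empty = inj₁ (0 , ([] , []) , [])
  toWords (ts ▷ evenEnd q a b) =
    let (gs , as) , bs = from triples↔ ts in inj₁ (_ , (q ∷ gs , as ∷ʳ a) , bs ∷ʳ b)
  toWords (ts ▷ oddEnd a) =
    let (gs , as) , bs = from triples↔ ts in inj₂ (_ , (gs , as ∷ʳ a) , bs)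

  fromWords : MiddleWords → FinSupp
  fromWords (inj₁ (zero  , ([] , [])     , []))  = empty
  fromWords (inj₁ (suc m , (q ∷ gs , as) , bs)) =
    triples gs (init as) (init bs) ▷ evenEnd q (last as) (last bs)
  fromWords (inj₂ (m     , (gs , as)     , bs)) = triples gs (init as) bs ▷ oddEnd (last as)

  fromWords-evenEnd : ∀ {m} q (gs : Vec Bool m) as bs a b →
    fromWords (inj₁ (suc m , (q ∷ gs , as ∷ʳ a) , bs ∷ʳ b)) ≡ triples gs as bs ▷ evenEnd q a b
  fromWords-evenEnd q gs as bs a b
    rewrite Vec.init-∷ʳ a as | Vec.last-∷ʳ a as | Vec.init-∷ʳ b bs | Vec.last-∷ʳ b bs = refl

  fromWords-oddEnd : ∀ {m} (gs : Vec Bool m) as bs a →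
    fromWords (inj₂ (m , (gs , as ∷ʳ a) , bs)) ≡ triples gs as bs ▷ oddEnd a
  fromWords-oddEnd gs as bs a rewrite Vec.init-∷ʳ a as | Vec.last-∷ʳ a as = refl

  init∷ʳlast : ∀ {A : Set} {n} (xs : Vec A (suc n)) → init xs ∷ʳ last xs ≡ xs
  init∷ʳlast xs = sym (proj₂ (proj₂ (Vec.initLast xs)))

  to∘from : ∀ x → toWords (fromWords x) ≡ x
  to∘from (inj₁ (zero  , ([] , [])     , []))  = refl
  to∘from (inj₁ (suc m , (q ∷ gs , as) , bs)) =
    trans (cong (λ ((gs , as′) , bs′) → inj₁ (suc m , (q ∷ gs , as′ ∷ʳ last as) , bs′ ∷ʳ last bs))
                (strictlyInverseʳ triples↔ ((gs , init as) , init bs)))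
          (cong₂ (λ as bs → inj₁ (suc m , (q ∷ gs , as) , bs)) (init∷ʳlast as) (init∷ʳlast bs))
  to∘from (inj₂ (m , (gs , as) , bs)) =
    trans (cong (λ ((gs , as′) , bs) → inj₂ (m , (gs , as′ ∷ʳ last as) , bs))
                (strictlyInverseʳ triples↔ ((gs , init as) , bs)))
          (cong (λ as → inj₂ (m , (gs , as) , bs)) (init∷ʳlast as))

  from∘to : ∀ s → fromWords (toWords s) ≡ s
  from∘to empty = refl
  from∘to (ts ▷ evenEnd q a b) =
    let (gs , as) , bs = from triples↔ ts in
    trans (fromWords-evenEnd q gs as bs a b) (cong (_▷ evenEnd q a b) (strictlyInverseˡ triples↔ ts))
  from∘to (ts ▷ oddEnd a) =
    let (gs , as) , bs = from triples↔ ts in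
    trans (fromWords-oddEnd gs as bs a) (cong (_▷ oddEnd a) (strictlyInverseˡ triples↔ ts))

finSupp-weight : ∀ s → middleWordsWeight (to finSupp↔words s) ≡ weightᶠ s
finSupp-weight empty = refl
finSupp-weight (ts ▷ evenEnd q a b) =
  let (gs , as) , bs = from triples↔ ts in
  trans (sym (evenEnd-middle-weight q gs as bs a b))
        (cong (λ ts → weightᶠ (ts ▷ evenEnd q a b)) (strictlyInverseˡ triples↔ ts))
finSupp-weight (ts ▷ oddEnd a) =
  let (gs , as) , bs = from triples↔ ts in
  trans (sym (oddEnd-middle-weight gs as bs a))
        (cong (λ ts → weightᶠ (ts ▷ oddEnd a)) (strictlyInverseˡ triples↔ ts))

middle-fibre : ∀ w → Fibre middleᶜ w ↔ fibre weightᶠ w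
middle-fibre w = ↔-trans (fibre-↔ {g = middleWordsWeight} middle↔words middle-weight w)
                         (↔-sym (fibre-↔ {g = middleWordsWeight} finSupp↔words finSupp-weight w))

-- Partitions in 𝒫₂

bit : Bool → ℕ
bit false = 0
bit true  = 1

parity : ℕ → Bool
parity zero          = false
parity (suc zero)    = true
parity (suc (suc n)) = parity n

double : ℕ → ℕ
double n = n + n

⌊double/2⌋ : ∀ n → ⌊ double n /2⌋ ≡ n
⌊double/2⌋ n = sym (n≡⌊n+n/2⌋ n)

⌊bit+double/2⌋ : ∀ g n → ⌊ bit g + double n /2⌋ ≡ n
⌊bit+double/2⌋ false n = ⌊double/2⌋ n
⌊bit+double/2⌋ true  n = sym (n≡⌈n+n/2⌉ n)

⌈bit+double/2⌉ : ∀ g n → ⌈ bit g + double n /2⌉ ≡ bit g + n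
⌈bit+double/2⌉ false n = sym (n≡⌈n+n/2⌉ n)
⌈bit+double/2⌉ true  n = cong suc (⌊double/2⌋ n)

+-double-suc : ∀ m n → m + double (suc n) ≡ suc (suc (m + double n))
+-double-suc m n = lemma m n
  where
  lemma : ∀ m n → m + (suc n + suc n) ≡ suc (suc (m + (n + n)))
  lemma = solve-∀

parity-bit+double : ∀ g n → parity (bit g + double n) ≡ g
parity-bit+double false zero    = refl
parity-bit+double true  zero    = refl
parity-bit+double g     (suc n) = trans (cong parity (+-double-suc (bit g) n)) (parity-bit+double g n)

bit+double-parity : ∀ n → bit (parity n) + double ⌊ n /2⌋ ≡ n
bit+double-parity zero          = refl
bit+double-parity (suc zero)    = refl
bit+double-parity (suc (suc n)) =
  trans (+-double-suc (bit (parity n)) ⌊ n /2⌋) (cong (suc ∘ suc) (bit+double-parity n))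

⌈/2⌉≡bit+⌊/2⌋ : ∀ n → ⌈ n /2⌉ ≡ bit (parity n) + ⌊ n /2⌋
⌈/2⌉≡bit+⌊/2⌋ zero          = refl
⌈/2⌉≡bit+⌊/2⌋ (suc zero)    = refl
⌈/2⌉≡bit+⌊/2⌋ (suc (suc n)) = trans (cong suc (⌈/2⌉≡bit+⌊/2⌋ n)) (sym (+-suc (bit (parity n)) ⌊ n /2⌋))

even⇒parity≡false : ∀ {n} → 2 ∣ n → parity n ≡ false
even⇒parity≡false (divides q refl) =
  trans (cong parity (trans (*-comm q 2) (cong (_+_ q) (+-identityʳ q)))) (parity-bit+double false q)

even⇒double : ∀ {n} → 2 ∣ n → double ⌊ n /2⌋ ≡ n
even⇒double {n} 2∣n =
  trans (cong (λ g → bit g + double ⌊ n /2⌋) (sym (even⇒parity≡false 2∣n))) (bit+double-parity n)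

even⇒⌈/2⌉≡⌊/2⌋ : ∀ {n} → 2 ∣ n → ⌈ n /2⌉ ≡ ⌊ n /2⌋
even⇒⌈/2⌉≡⌊/2⌋ {n} 2∣n = trans (⌈/2⌉≡bit+⌊/2⌋ n) (cong (λ g → bit g + ⌊ n /2⌋) (even⇒parity≡false 2∣n))

∣_∣ᵗ : Triple → ℕ
∣ g , a , b ∣ᵗ = a + b + bit g

height : List Triple → ℕ
height []       = 0
height (t ∷ ts) = ∣ t ∣ᵗ + height ts

heightᶠ : FinSupp → ℕ
heightᶠ s = height (elements s)

upperRow lowerRow : Triple → ℕ → ℕ
upperRow t           h = double (∣ t ∣ᵗ + h)
lowerRow (g , a , b) h = bit g + double (b + h)

lowerRows : ∀ {n} → Vec Triple n → LastTriple → List ℕ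
lowerRows []       (oddEnd a)      = []
lowerRows []       (evenEnd g a b) = lowerRow ⌜ evenEnd g a b ⌝ 0 ∷ []
lowerRows (t ∷ ts) z               = lowerRow t h ∷ double h ∷ lowerRows ts z
  where h = heightᶠ (ts ▷ z)

rows : FinSupp → List ℕ
rows empty    = []
rows (ts ▷ z) = double (heightᶠ (ts ▷ z)) ∷ lowerRows ts z

-- Inverts the formulas for the parts: from λ₂ₙ₊₁, λ₂ₙ₊₂ and hₙ = λ₂ₙ₊₃ / 2, reading a missing
-- part as 0.
decode : ℕ → ℕ → ℕ → Triple
decode e o h = parity o , ⌊ e /2⌋ ∸ ⌈ o /2⌉ , ⌊ o /2⌋ ∸ h

parse : List ℕ → FinSupp
parse []                  = empty
parse (e ∷ [])            = decode e 0 0 ◁ empty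
parse (e ∷ o ∷ [])        = decode e o 0 ◁ empty
parse (e ∷ o ∷ e′ ∷ rest) = decode e o ⌊ e′ /2⌋ ◁ parse (e′ ∷ rest)

decode-rows : ∀ t h → decode (upperRow t h) (lowerRow t h) h ≡ t
decode-rows (g , a , b) h = cong₂ _,_ (parity-bit+double g (b + h)) (cong₂ _,_ a≡ b≡)
  where
  a≡ : ⌊ double (a + b + bit g + h) /2⌋ ∸ ⌈ bit g + double (b + h) /2⌉ ≡ a
  a≡ = begin
    ⌊ double (a + b + bit g + h) /2⌋ ∸ ⌈ bit g + double (b + h) /2⌉
      ≡⟨ cong₂ _∸_ (⌊double/2⌋ (a + b + bit g + h)) (⌈bit+double/2⌉ g (b + h)) ⟩
    a + b + bit g + h ∸ (bit g + (b + h))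
      ≡⟨ cong (_∸ (bit g + (b + h))) (reassoc a b (bit g) h) ⟩
    a + (bit g + (b + h)) ∸ (bit g + (b + h))
      ≡⟨ m+n∸n≡m a (bit g + (b + h)) ⟩
    a ∎
    where
    open ≡-Reasoning
    reassoc : ∀ a b g h → a + b + g + h ≡ a + (g + (b + h))
    reassoc = solve-∀
  b≡ : ⌊ bit g + double (b + h) /2⌋ ∸ h ≡ b
  b≡ = trans (cong (_∸ h) (⌊bit+double/2⌋ g (b + h))) (m+n∸n≡m b h)

⟪⌜z⌝⟫ : ∀ z → ⟪ ⌜ z ⌝ ⟫ ≡ [] ▷ z
⟪⌜z⌝⟫ (oddEnd a)          = refl
⟪⌜z⌝⟫ (evenEnd false a b) = refl
⟪⌜z⌝⟫ (evenEnd true  a b) = refl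

parse-rows : ∀ s → parse (rows s) ≡ s
parse-rows empty    = refl
parse-rows (ts ▷ z) = go ts z
  where
  go : ∀ {n} (ts : Vec Triple n) z → parse (rows (ts ▷ z)) ≡ ts ▷ z
  go []       (oddEnd a) =
    trans (cong (_◁ empty) (decode-rows ⌜ oddEnd a ⌝ 0)) (⟪⌜z⌝⟫ (oddEnd a))
  go []       (evenEnd g a b) =
    trans (cong (_◁ empty) (decode-rows ⌜ evenEnd g a b ⌝ 0)) (⟪⌜z⌝⟫ (evenEnd g a b))
  go (t ∷ ts) z =
    cong₂ _◁_ (trans (cong (decode _ _) (⌊double/2⌋ h)) (decode-rows t h)) (go ts z)
    where h = heightᶠ (ts ▷ z)

IsP2Rows : List ℕ → Set
IsP2Rows ps = All (0 <_) ps × Linked _≥_ ps × All (2 ∣_) (oddParts ps)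

rows-decode : ∀ {e o h} → 2 ∣ e → ⌈ o /2⌉ ≤ ⌊ e /2⌋ → h ≤ ⌊ o /2⌋ →
              upperRow (decode e o h) h ≡ e × lowerRow (decode e o h) h ≡ o
rows-decode {e} {o} {h} 2∣e ⌈o/2⌉≤E h≤O = upper , lower
  where
  open ≡-Reasoning
  g = parity o
  E = ⌊ e /2⌋
  O = ⌊ o /2⌋
  reassoc : ∀ x y g h → x + y + g + h ≡ x + (g + (y + h))
  reassoc = solve-∀
  upper : double ((E ∸ ⌈ o /2⌉) + (O ∸ h) + bit g + h) ≡ e
  upper = begin
    double ((E ∸ ⌈ o /2⌉) + (O ∸ h) + bit g + h)
      ≡⟨ cong double (reassoc (E ∸ ⌈ o /2⌉) (O ∸ h) (bit g) h) ⟩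
    double ((E ∸ ⌈ o /2⌉) + (bit g + (O ∸ h + h)))
      ≡⟨ cong (λ x → double ((E ∸ ⌈ o /2⌉) + (bit g + x))) (m∸n+n≡m h≤O) ⟩
    double ((E ∸ ⌈ o /2⌉) + (bit g + O))
      ≡⟨ cong (λ x → double ((E ∸ ⌈ o /2⌉) + x)) (sym (⌈/2⌉≡bit+⌊/2⌋ o)) ⟩
    double ((E ∸ ⌈ o /2⌉) + ⌈ o /2⌉)
      ≡⟨ cong double (m∸n+n≡m ⌈o/2⌉≤E) ⟩
    double E
      ≡⟨ even⇒double 2∣e ⟩
    e ∎
  lower : bit g + double (O ∸ h + h) ≡ o
  lower = trans (cong (λ x → bit g + double x) (m∸n+n≡m h≤O)) (bit+double-parity o)

rows-◁ : ∀ t s {e′ rest} → rows s ≡ e′ ∷ rest →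
         rows (t ◁ s) ≡ upperRow t ⌊ e′ /2⌋ ∷ lowerRow t ⌊ e′ /2⌋ ∷ e′ ∷ rest
rows-◁ t (ts ▷ z) refl =
  cong (λ h → upperRow t h ∷ lowerRow t h ∷ rows (ts ▷ z)) (sym (⌊double/2⌋ (heightᶠ (ts ▷ z))))

rows-⟪⟫₂ : ∀ t → 0 < lowerRow t 0 → rows ⟪ t ⟫ ≡ upperRow t 0 ∷ lowerRow t 0 ∷ []
rows-⟪⟫₂ (true  , a , b)     _  = refl
rows-⟪⟫₂ (false , a , suc b) _  = refl
rows-⟪⟫₂ (false , a , zero)  ()

rows-⟪⟫₁ : ∀ E → 0 < E → rows ⟪ false , E , 0 ⟫ ≡ double E ∷ []
rows-⟪⟫₁ (suc E) _ =
  cong (λ x → double (suc x) ∷ []) (trans (+-identityʳ _) (trans (+-identityʳ _) (+-identityʳ E)))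

half-pos : ∀ {e} → 2 ∣ e → 0 < e → 0 < ⌊ e /2⌋
half-pos {e} 2∣e 0<e with ⌊ e /2⌋ | even⇒double 2∣e
... | suc _ | _    = s≤s z≤n
... | zero  | refl = contradiction 0<e (λ ())

⌈/2⌉≤⌊/2⌋ : ∀ {e o} → 2 ∣ e → o ≤ e → ⌈ o /2⌉ ≤ ⌊ e /2⌋
⌈/2⌉≤⌊/2⌋ 2∣e o≤e = subst (_ ≤_) (even⇒⌈/2⌉≡⌊/2⌋ 2∣e) (⌈n/2⌉-mono o≤e)

rows-parse : ∀ ps → IsP2Rows ps → rows (parse ps) ≡ ps
rows-parse [] _ = refl
rows-parse (e ∷ []) (0<e ∷ [] , _ , 2∣e ∷ []) =
  trans (rows-⟪⟫₁ ⌊ e /2⌋ (half-pos 2∣e 0<e)) (cong (_∷ []) (even⇒double 2∣e))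
rows-parse (e ∷ o ∷ []) (_ ∷ 0<o ∷ [] , e≥o ∷ [-] , 2∣e ∷ []) =
  let upper , lower = rows-decode 2∣e (⌈/2⌉≤⌊/2⌋ 2∣e e≥o) z≤n in
  trans (rows-⟪⟫₂ (decode e o 0) (subst (0 <_) (sym lower) 0<o))
        (cong₂ (λ x y → x ∷ y ∷ []) upper lower)
rows-parse (e ∷ o ∷ e′ ∷ rest) (_ ∷ _ ∷ pos , e≥o ∷ o≥e′ ∷ lnk , 2∣e ∷ evens) =
  let upper , lower = rows-decode 2∣e (⌈/2⌉≤⌊/2⌋ 2∣e e≥o) (⌊n/2⌋-mono o≥e′) in
  trans (rows-◁ (decode e o ⌊ e′ /2⌋) (parse (e′ ∷ rest)) (rows-parse (e′ ∷ rest) (pos , lnk , evens)))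
        (cong₂ (λ x y → x ∷ y ∷ e′ ∷ rest) upper lower)

double-pos : ∀ {n} → 0 < n → 0 < double n
double-pos {n} 0<n = ≤-trans 0<n (m≤m+n n n)

double-even : ∀ n → 2 ∣ double n
double-even n = divides n (trans (cong (_+_ n) (sym (+-identityʳ n))) (*-comm 2 n))

lowerRow≤upperRow : ∀ t h → lowerRow t h ≤ upperRow t h
lowerRow≤upperRow (g , a , b) h =
  ≤-trans (m≤m+n (bit g + double (b + h)) (double a + bit g)) (≤-reflexive (split a b (bit g) h))
  where
  split : ∀ a b g h → g + ((b + h) + (b + h)) + ((a + a) + g) ≡ (a + b + g + h) + (a + b + g + h)
  split = solve-∀

double≤lowerRow : ∀ t h → double h ≤ lowerRow t h
double≤lowerRow (g , a , b) h = ≤-trans (+-mono-≤ (m≤n+m h b) (m≤n+m h b)) (m≤n+m _ (bit g))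

heightᶠ-pos : ∀ {n} (ts : Vec Triple n) z → 0 < heightᶠ (ts ▷ z)
heightᶠ-pos []       z = ≤-trans (0<∣⌜z⌝∣ z) (m≤m+n _ 0)
  where
  0<∣⌜z⌝∣ : ∀ z → 0 < ∣ ⌜ z ⌝ ∣ᵗ
  0<∣⌜z⌝∣ (oddEnd a)          = s≤s z≤n
  0<∣⌜z⌝∣ (evenEnd false a b) = ≤-trans (s≤s z≤n) (≤-trans (m≤n+m (suc b) a) (m≤m+n _ 0))
  0<∣⌜z⌝∣ (evenEnd true  a b) = m≤n+m 1 (a + b)
heightᶠ-pos (t ∷ ts) z = ≤-trans (heightᶠ-pos ts z) (m≤n+m _ ∣ t ∣ᵗ)

rows-positive : ∀ s → All (0 <_) (rows s)
rows-positive empty    = []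
rows-positive (ts ▷ z) = double-pos (heightᶠ-pos ts z) ∷ lower ts z
  where
  lower : ∀ {n} (ts : Vec Triple n) z → All (0 <_) (lowerRows ts z)
  lower []       (oddEnd a)          = []
  lower []       (evenEnd false a b) = s≤s z≤n ∷ []
  lower []       (evenEnd true  a b) = s≤s z≤n ∷ []
  lower (t ∷ ts) z = ≤-trans 0<2h (double≤lowerRow t _) ∷ 0<2h ∷ lower ts z
    where 0<2h = double-pos (heightᶠ-pos ts z)

rows-linked : ∀ s → Linked _≥_ (rows s)
rows-linked empty    = []
rows-linked (ts ▷ z) = go ts z
  where
  go : ∀ {n} (ts : Vec Triple n) z → Linked _≥_ (rows (ts ▷ z))
  go []       (oddEnd a)      = [-]
  go []       (evenEnd g a b) = lowerRow≤upperRow ⌜ evenEnd g a b ⌝ 0 ∷ [-]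
  go (t ∷ ts) z = lowerRow≤upperRow t h ∷ double≤lowerRow t h ∷ go ts z
    where h = heightᶠ (ts ▷ z)

rows-even : ∀ s → All (2 ∣_) (oddParts (rows s))
rows-even empty    = []
rows-even (ts ▷ z) = go ts z
  where
  go : ∀ {n} (ts : Vec Triple n) z → All (2 ∣_) (oddParts (rows (ts ▷ z)))
  go []       z = double-even (heightᶠ ([] ▷ z)) ∷ lower z
    where
    lower : ∀ z → All (2 ∣_) (evenParts (lowerRows [] z))
    lower (oddEnd a)      = []
    lower (evenEnd g a b) = []
  go (t ∷ ts) z = double-even (heightᶠ ((t ∷ ts) ▷ z)) ∷ go ts z

rowsWeight : List ℕ → Weight
rowsWeight ps =
  ( sum (List.map ⌈_/2⌉ (oddParts ps)) , sum (List.map ⌊_/2⌋ (oddParts ps))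
  , sum (List.map ⌈_/2⌉ (evenParts ps)) , sum (List.map ⌊_/2⌋ (evenParts ps)) )

pairWeight : ℕ → ℕ → Weight
pairWeight x y = (⌈ x /2⌉ , ⌊ x /2⌋ , ⌈ y /2⌉ , ⌊ y /2⌋)

tripleWeight-0 : ∀ g a b → tripleWeight 0 (g , a , b) ≡ (a + b + bit g , a + b + bit g , bit g + b , b)
tripleWeight-0 true a b = cong-weight (e a b) (e a b) (cong suc (e′ a b)) (e′ a b)
  where
  e : ∀ a b → 1 + a * 1 + b * 1 ≡ a + b + 1
  e = solve-∀
  e′ : ∀ a b → a * 0 + b * 1 ≡ b
  e′ = solve-∀
tripleWeight-0 false a b = cong-weight (e a b) (e a b) (e′ a b) (e′ a b)
  where
  e : ∀ a b → a * 1 + b * 1 ≡ a + b + 0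
  e = solve-∀
  e′ : ∀ a b → a * 0 + b * 1 ≡ b
  e′ = solve-∀

pairWeight-rows : ∀ t h → pairWeight (upperRow t h) (lowerRow t h) ≡ tripleWeight 0 t +ʷ Q^ h
pairWeight-rows t@(g , a , b) h = begin
  pairWeight (upperRow t h) (lowerRow t h)
    ≡⟨ cong-weight (sym (n≡⌈n+n/2⌉ _)) (⌊double/2⌋ _)
                   (⌈bit+double/2⌉ g (b + h)) (⌊bit+double/2⌋ g (b + h)) ⟩
  (∣ t ∣ᵗ + h , ∣ t ∣ᵗ + h , bit g + (b + h) , b + h)
    ≡⟨ cong (λ c → (∣ t ∣ᵗ + h , ∣ t ∣ᵗ + h , c , b + h)) (sym (+-assoc (bit g) b h)) ⟩
  (∣ t ∣ᵗ , ∣ t ∣ᵗ , bit g + b , b) +ʷ Q^ h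
    ≡⟨ cong (_+ʷ Q^ h) (sym (tripleWeight-0 g a b)) ⟩
  tripleWeight 0 t +ʷ Q^ h ∎
  where open ≡-Reasoning

·ʷ-shift : ∀ a u → a ·ʷ (Q^ 1 +ʷ u) ≡ a ·ʷ u +ʷ Q^ a
·ʷ-shift a (p , q , r , s) = cong-weight (*-suc′ p) (*-suc′ q) (*-suc′ r) (*-suc′ s)
  where
  *-suc′ : ∀ n → a * suc n ≡ a * n + a
  *-suc′ n = trans (*-suc a n) (+-comm a (a * n))

tripleWeight-suc : ∀ i t → tripleWeight (suc i) t ≡ tripleWeight i t +ʷ Q^ ∣ t ∣ᵗ
tripleWeight-suc i (g , a , b) = begin
  weight (γᶜ (suc i)) g +ʷ a ·ʷ (Q^ 1 +ʷ abQ^ i) +ʷ b ·ʷ (Q^ 1 +ʷ Q^ suc i)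
    ≡⟨ cong₂ _+ʷ_ (cong₂ _+ʷ_ (γ-shift g) (·ʷ-shift a (abQ^ i))) (·ʷ-shift b (Q^ suc i)) ⟩
  (γ +ʷ Q^ bit g) +ʷ (α +ʷ Q^ a) +ʷ (β +ʷ Q^ b)
    ≡⟨ solve 6 (λ γ Qᵍ α Qᵃ β Qᵇ → ((γ ∙ Qᵍ) ∙ (α ∙ Qᵃ)) ∙ (β ∙ Qᵇ) ⊜ ((γ ∙ α) ∙ β) ∙ ((Qᵃ ∙ Qᵇ) ∙ Qᵍ))
         refl γ (Q^ bit g) α (Q^ a) β (Q^ b) ⟩
  γ +ʷ α +ʷ β +ʷ Q^ (a + b + bit g) ∎
  where
  open ≡-Reasoning
  open +ʷ-Solver using (solve; _⊜_) renaming (_⊕_ to _∙_)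
  γ = weight (γᶜ i) g
  α = a ·ʷ abQ^ i
  β = b ·ʷ Q^ suc i
  γ-shift : ∀ g → weight (γᶜ (suc i)) g ≡ weight (γᶜ i) g +ʷ Q^ bit g
  γ-shift false = refl
  γ-shift true  = cong-weight (+-comm 1 (suc i)) (+-comm 1 (suc i)) (+-comm 1 (suc i)) (+-comm 1 i)

indexedSum-suc : ∀ i l → indexedSum tripleWeight (suc i) l ≡ indexedSum tripleWeight i l +ʷ Q^ height l
indexedSum-suc i []       = refl
indexedSum-suc i (t ∷ ts) = begin
  tripleWeight (suc i) t +ʷ indexedSum tripleWeight (suc (suc i)) ts
    ≡⟨ cong₂ _+ʷ_ (tripleWeight-suc i t) (indexedSum-suc (suc i) ts) ⟩
  tripleWeight i t +ʷ Q^ ∣ t ∣ᵗ +ʷ (S +ʷ Q^ height ts)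
    ≡⟨ solve 4 (λ T Qᵗ S Qʰ → (T ∙ Qᵗ) ∙ (S ∙ Qʰ) ⊜ (T ∙ S) ∙ (Qᵗ ∙ Qʰ)) refl
         (tripleWeight i t) (Q^ ∣ t ∣ᵗ) S (Q^ height ts) ⟩
  tripleWeight i t +ʷ S +ʷ Q^ (∣ t ∣ᵗ + height ts) ∎
  where
  open ≡-Reasoning
  open +ʷ-Solver using (solve; _⊜_) renaming (_⊕_ to _∙_)
  S = indexedSum tripleWeight (suc i) ts

rowsWeight-rows : ∀ s → rowsWeight (rows s) ≡ weightᶠ s
rowsWeight-rows empty    = refl
rowsWeight-rows (ts ▷ z) = go ts z
  where
  go : ∀ {n} (ts : Vec Triple n) z → rowsWeight (rows (ts ▷ z)) ≡ weightᶠ (ts ▷ z)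
  go [] z = begin
    rowsWeight (rows ([] ▷ z))
      ≡⟨ last-pair z ⟩
    pairWeight (upperRow ⌜ z ⌝ 0) (lowerRow ⌜ z ⌝ 0) +ʷ 0ʷ
      ≡⟨ cong (_+ʷ 0ʷ) (trans (pairWeight-rows ⌜ z ⌝ 0) (+ʷ-identityʳ (tripleWeight 0 ⌜ z ⌝))) ⟩
    tripleWeight 0 ⌜ z ⌝ +ʷ 0ʷ ∎
    where
    open ≡-Reasoning
    last-pair : ∀ z →
      rowsWeight (rows ([] ▷ z)) ≡ pairWeight (upperRow ⌜ z ⌝ 0) (lowerRow ⌜ z ⌝ 0) +ʷ 0ʷ
    last-pair (oddEnd a)      = refl
    last-pair (evenEnd g a b) = refl
  go (t ∷ ts) z = begin
    pairWeight (upperRow t h) (lowerRow t h) +ʷ rowsWeight (rows (ts ▷ z))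
      ≡⟨ cong₂ _+ʷ_ (pairWeight-rows t h) (go ts z) ⟩
    tripleWeight 0 t +ʷ Q^ h +ʷ weightᶠ (ts ▷ z)
      ≡⟨ solve 3 (λ T Qʰ W → (T ∙ Qʰ) ∙ W ⊜ T ∙ (W ∙ Qʰ)) refl
           (tripleWeight 0 t) (Q^ h) (weightᶠ (ts ▷ z)) ⟩
    tripleWeight 0 t +ʷ (weightᶠ (ts ▷ z) +ʷ Q^ h)
      ≡⟨ cong (tripleWeight 0 t +ʷ_) (sym (indexedSum-suc 0 (elements (ts ▷ z)))) ⟩
    weightᶠ ((t ∷ ts) ▷ z) ∎
    where
    open ≡-Reasoning
    open +ʷ-Solver using (solve; _⊜_) renaming (_⊕_ to _∙_)
    h = heightᶠ (ts ▷ z)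

2∣-irrelevant : ∀ {n} (p q : 2 ∣ n) → p ≡ q
2∣-irrelevant (divides q n≡q*2) (divides q′ n≡q′*2)
  with *-cancelʳ-≡ q q′ 2 (trans (sym n≡q*2) n≡q′*2)
... | refl = cong (divides q) (uip n≡q*2 n≡q′*2)

P2 : Set
P2 = Σ Partition InP2

P2-≡ : ∀ {x y : P2} → parts (proj₁ x) ≡ parts (proj₁ y) → x ≡ y
P2-≡ {mkPartition ps pos lnk , ev} {mkPartition .ps pos′ lnk′ , ev′} refl
  rewrite All.irrelevant <-irrelevant pos pos′ | Linked.irrelevant ≤-irrelevant lnk lnk′
        | All.irrelevant 2∣-irrelevant ev ev′ = refl

finSupp↔P2 : FinSupp ↔ P2
finSupp↔P2 = mk↔ₛ′
  (λ s → mkPartition (rows s) (rows-positive s) (rows-linked s) , rows-even s)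
  (λ (p , _) → parse (parts p))
  (λ (p , ev) → P2-≡ (rows-parse (parts p) (positive p , decr p , ev)))
  parse-rows

finSupp-fibre↔P2With : ∀ i j k l → fibre weightᶠ (i , j , k , l) ↔ P2With i j k l
finSupp-fibre↔P2With i j k l =
  ↔-trans (fibre-↔ {g = weightExp ∘ proj₁} finSupp↔P2 rowsWeight-rows (i , j , k , l)) Σ-assoc

mainTheorem4 : (i j k l : ℕ) →
    Σ ℕ (λ N → (Fin N ↔ P2With i j k l) × (+ N ≡ middleSeries i j k l))
    × (middleSeries i j k l ≡ productSeries i j k l)
mainTheorem4 i j k l =
  (count middleᶜ w , enumeration , sym (middle-isGF w)) ,
  trans (middle-isGF w) (trans (cong +_ same-count) (sym (productSeries-agree w w ≤ʷ-refl)))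
  where
  w = (i , j , k , l)
  enumeration : Fin (count middleᶜ w) ↔ P2With i j k l
  enumeration = ↔-trans (enum middleᶜ w) (↔-trans (middle-fibre w) (finSupp-fibre↔P2With i j k l))
  same-count : count middleᶜ w ≡ count (productᶜ (suc ∣ w ∣ʷ)) w
  same-count = count-≡ middleᶜ (productᶜ (suc ∣ w ∣ʷ))
                 (↔-trans (middle-fibre w) (↔-sym (product-fibre (suc ∣ w ∣ʷ) w ≤-refl)))
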